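{- Let $\Lambda=(\Lambda_1,\Lambda_2,\dots)$ be a strict partition, $\Gamma=(\Lambda_2,\Lambda_3,\dots)$, and $\Psi$ a strict partition with $\Gamma\subseteq\Psi\subseteq\Lambda$. Then, as an identity of rational functions in $t$ (over $\mathbb{Z}[\beta]$), \[ jq^{\mathrm{comb}}_{\Lambda/\Psi}(t) = (2t^2-\beta t)(t-\beta)^{\mathsf{res}-2}\, 2^{\mathsf{scc}}\, t^{\mathsf{scc}+\mathsf{mcc}+\mathsf{fb}-1}(2t-\beta)^{\mathsf{mcc}-1}. \]
   Context: For strict partitions $\mu\subseteq\lambda$, $\mathsf{SD}_{\lambda/\mu}=\mathsf{SD}_\lambda\setminus\mathsf{SD}_\mu$ where $\mathsf{SD}_\lambda=\{(i,i+j-1):1\le i\le\ell(\lambda),1\le j\le\lambda_i\}$; $|\lambda/\mu|=|\lambda|-|\mu|$. Primed numbers $i'=i-\tfrac12$, ordered $1'<1<2'<2<\dots$. A shifted bar tableau of shape $\lambda/\mu$ is a pair $(V,\Pi)$: $V$ fills each box with one element of $\{1'<1<\dots\}$, no unprimed entry repeated in a column, no primed entry repeated in a row; $\Pi$ partitions the boxes into nonempty bars of contiguous boxes in one row or column with equal entries; semistandard means $V$ weakly increases along rows and columns. $|T|$ = number of bars, ${\bf x}^T=\prod x_i^{b_i}$ ($b_i$ = number of bars containing $i$ or $i'$). $jq^{\mathrm{comb}}_{\lambda/\mu}=\sum(-\beta)^{|\lambda/\mu|-|T|}{\bf x}^T$ over semistandard shifted bar tableaux of shape $\lambda/\mu$.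 For a power series $f$ in $x_1,x_2,\dots$, $f(t)$ denotes the result of substituting $x_1\mapsto t$ and $x_i\mapsto0$ for $i>1$. Boxes are connected when they share an edge. A forced box of $\mathsf{SD}_{\Lambda/\Psi}$ is a box $(i,j)\in\mathsf{SD}_{\Lambda/\Psi}$ such that either $(i+1,j),(i+1,j-1)\in\mathsf{SD}_{\Lambda/\Psi}$ or $(i,j-1),(i+1,j-1)\in\mathsf{SD}_{\Lambda/\Psi}$. Let $\mathsf{scc}$ be the number of connected components of $\mathsf{SD}_{\Lambda/\Psi}$ consisting of a single box, $\mathsf{mcc}$ the number of connected components with more than one box, $\mathsf{fb}$ the number of forced boxes, and $\mathsf{res}=|\Lambda|-|\Psi|-\mathsf{scc}-2\mathsf{mcc}-\mathsf{fb}+2$. -}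

module Defs where

open import Data.Nat as ℕ using (ℕ; zero; suc; _≤_; _<_; _≤ᵇ_; _<ᵇ_; _∸_; _%_)
open import Data.Nat.Properties using () renaming (_≟_ to _≟ℕ_)
open import Data.Integer as ℤ using (ℤ; +_; -[1+_]; 0ℤ; 1ℤ)
open import Data.Bool using (Bool; true; false; _∧_; _∨_; not; if_then_else_)
open import Data.List using (List; []; _∷_; length; map; concatMap; upTo; foldr; drop)
open import Data.Nat.ListAction using (sum)
open import Data.Bool.ListAction using (any)
open import Data.List.Relation.Unary.All using (All)
open import Data.List.Relation.Unary.Any using (Any)
open import Data.List.Relation.Unary.Linked using (Linked)
open import Data.List.Relation.Unary.AllPairs using (AllPairs)
open import Data.Product using (_×_; _,_; proj₁; proj₂; Σ; ∃)
open import Data.Sum using (_⊎_)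
open import Relation.Binary.PropositionalEquality using (_≡_; _≢_)
open import Relation.Nullary using (¬_; does)

StrictPartition : List ℕ → Set
StrictPartition λs = All (λ k → 1 ≤ k) λs × Linked (λ a b → b < a) λs

-- λ_i, 1-indexed, with λ_i = 0 for i > ℓ(λ) (and for i = 0).
part : List ℕ → ℕ → ℕ
part []       _             = 0
part (x ∷ xs) zero          = 0
part (x ∷ xs) (suc zero)    = x
part (x ∷ xs) (suc (suc i)) = part xs (suc i)

Box : Set
Box = ℕ × ℕ

row col : Box → ℕ
row = proj₁
col = proj₂

inSD : List ℕ → Box → Bool
inSD λs (i , j) = (1 ≤ᵇ i) ∧ (i ≤ᵇ length λs) ∧ (i ≤ᵇ j) ∧ (j <ᵇ i ℕ.+ part λs i)

_⊆SD_ : List ℕ → List ℕ → Set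
μ ⊆SD λs = ∀ b → inSD μ b ≡ true → inSD λs b ≡ true

skew : List ℕ → List ℕ → Box → Bool
skew λs μ b = inSD λs b ∧ not (inSD μ b)

Sk : List ℕ → List ℕ → Box → Set
Sk λs μ b = skew λs μ b ≡ true

sdBoxes : List ℕ → List Box
sdBoxes λs = concatMap (λ i → map (λ k → (i , i ℕ.+ k)) (upTo (part λs i)))
                       (map suc (upTo (length λs)))

filterB : {A : Set} → (A → Bool) → List A → List A
filterB p []       = []
filterB p (x ∷ xs) = if p x then x ∷ filterB p xs else filterB p xs

skewBoxes : List ℕ → List ℕ → List Box
skewBoxes λs μ = filterB (λ b → not (inSD μ b)) (sdBoxes λs)

size : List ℕ → List ℕ → ℕ
size λs μ = sum λs ∸ sum μ

Adj : Box → Box → Set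
Adj b c = (row b ≡ row c × (suc (col b) ≡ col c ⊎ suc (col c) ≡ col b))
        ⊎ (col b ≡ col c × (suc (row b) ≡ row c ⊎ suc (row c) ≡ row b))

data Reach (λs μ : List ℕ) : Box → Box → Set where
  here : ∀ {b} → Sk λs μ b → Reach λs μ b b
  step : ∀ {b c d} → Reach λs μ b c → Adj c d → Sk λs μ d → Reach λs μ b d

HasNbr : List ℕ → List ℕ → Box → Set
HasNbr λs μ b = ∃ λ d → Adj b d × Sk λs μ d

-- reps lists exactly one box from each connected component of
-- SD_{λ/μ} having more than one box; then mcc = length reps.
MCCReps : List ℕ → List ℕ → List Box → Set
MCCReps λs μ reps =
    All (λ r → Sk λs μ r × HasNbr λs μ r) reps
  × AllPairs (λ r s → ¬ Reach λs μ r s) reps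
  × (∀ b → Sk λs μ b → HasNbr λs μ b → Any (λ r → Reach λs μ r b) reps)

-- the four edge-neighbours of a box (exact for boxes with i, j ≥ 1)
nbrs : Box → List Box
nbrs (i , j) = (i , suc j) ∷ (i , j ∸ 1) ∷ (suc i , j) ∷ (i ∸ 1 , j) ∷ []

scc : List ℕ → List ℕ → ℕ
scc λs μ = length (filterB (λ b → not (any (skew λs μ) (nbrs b))) (skewBoxes λs μ))

isForced : List ℕ → List ℕ → Box → Bool
isForced λs μ (i , j) =
    (skew λs μ (suc i , j) ∧ skew λs μ (suc i , j ∸ 1))
  ∨ (skew λs μ (i , j ∸ 1) ∧ skew λs μ (suc i , j ∸ 1))

fb : List ℕ → List ℕ → ℕ
fb λs μ = length (filterB (isForced λs μ) (skewBoxes λs μ))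

-- Shifted bar tableaux
-- Entries {1' < 1 < 2' < 2 < ...} are encoded by ℕ: i' ↦ 2i-1, i ↦ 2i.
-- So the order is the order of ℕ, primed = odd, and the index of the
-- variable x_i attached to a code k is i = ⌊(k+1)/2⌋.

Primed : ℕ → Set
Primed k = k % 2 ≡ 1

Unprimed : ℕ → Set
Unprimed k = k % 2 ≡ 0

varIndex : ℕ → ℕ
varIndex k = (suc k) ℕ./ 2

-- V : filling; rep : the bar partition Π, given by sending each box to a
-- chosen representative box of its bar (two boxes lie in the same bar
-- iff they have the same representative).  Only values on boxes of
-- SD_{λ/μ} matter.
record Tableau : Set where
  constructor tab
  field
    V   : Box → ℕ
    rep : Box → Box
open Tableau public

Between : Box → Box → Box → Set
Between b c d = (row b ≡ row c × row d ≡ row b × col b ≤ col d × col d ≤ col c)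
              ⊎ (col b ≡ col c × col d ≡ col b × row b ≤ row d × row d ≤ row c)

record IsBarTableau (λs μ : List ℕ) (T : Tableau) : Set where
  field
    entryPos  : ∀ b → Sk λs μ b → 1 ≤ V T b
    colUnpr   : ∀ b c → Sk λs μ b → Sk λs μ c → b ≢ c → col b ≡ col c →
                V T b ≡ V T c → Primed (V T b)
    rowPrim   : ∀ b c → Sk λs μ b → Sk λs μ c → b ≢ c → row b ≡ row c →
                V T b ≡ V T c → Unprimed (V T b)
    repSk     : ∀ b → Sk λs μ b → Sk λs μ (rep T b)
    repIdem   : ∀ b → Sk λs μ b → rep T (rep T b) ≡ rep T b
    barEntry  : ∀ b c → Sk λs μ b → Sk λs μ c → rep T b ≡ rep T c → V T b ≡ V T c
    barLine   : ∀ b c → Sk λs μ b → Sk λs μ c → rep T b ≡ rep T c →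
                row b ≡ row c ⊎ col b ≡ col c
    barContig : ∀ b c d → Sk λs μ b → Sk λs μ c → rep T b ≡ rep T c →
                Between b c d → Sk λs μ d × rep T d ≡ rep T b

record IsSemistandard (λs μ : List ℕ) (T : Tableau) : Set where
  field
    bar    : IsBarTableau λs μ T
    rowInc : ∀ i j → Sk λs μ (i , j) → Sk λs μ (i , suc j) → V T (i , j) ≤ V T (i , suc j)
    colInc : ∀ i j → Sk λs μ (i , j) → Sk λs μ (suc i , j) → V T (i , j) ≤ V T (suc i , j)

_≈[_,_]_ : Tableau → List ℕ → List ℕ → Tableau → Set
T ≈[ λs , μ ] T' =
    (∀ b → Sk λs μ b → V T b ≡ V T' b)
  × (∀ b c → Sk λs μ b → Sk λs μ c →
       (rep T b ≡ rep T c → rep T' b ≡ rep T' c)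
     × (rep T' b ≡ rep T' c → rep T b ≡ rep T c))

eqBox : Box → Box → Bool
eqBox (a , b) (c , d) = does (a ≟ℕ c) ∧ does (b ≟ℕ d)

barReps : List ℕ → List ℕ → Tableau → List Box
barReps λs μ T = filterB (λ b → eqBox (rep T b) b) (skewBoxes λs μ)

numBars : List ℕ → List ℕ → Tableau → ℕ
numBars λs μ T = length (barReps λs μ T)

monoAt : List ℕ → List ℕ → Tableau → (ℕ → ℤ) → ℤ
monoAt λs μ T x = foldr (λ b acc → x (varIndex (V T b)) ℤ.* acc) 1ℤ (barReps λs μ T)

spec : ℤ → ℕ → ℤ
spec t (suc zero) = t
spec t _          = 0ℤ

term : List ℕ → List ℕ → Tableau → ℤ → ℤ → ℤ
term λs μ T t β = (ℤ.- β) ℤ.^ (size λs μ ∸ numBars λs μ T) ℤ.* monoAt λs μ T (spec t)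

sumTerms : List ℕ → List ℕ → List Tableau → ℤ → ℤ → ℤ
sumTerms λs μ L t β = foldr (λ T acc → term λs μ T t β ℤ.+ acc) 0ℤ L

-- integer exponents: z = pos z - neg z

pos neg : ℤ → ℕ
pos (+ n)      = n
pos -[1+ n ]   = 0
neg (+ n)      = 0
neg -[1+ n ]   = suc n

res : List ℕ → List ℕ → ℕ → ℤ
res λs μ mcc = + size λs μ ℤ.- + scc λs μ ℤ.- + (2 ℕ.* mcc) ℤ.- + fb λs μ ℤ.+ + 2

{-# OPTIONS --safe #-}

-- Because Γ ⊆ Ψ, no two boxes of SD_{Λ/Ψ} are diagonal neighbours, so every connected component
-- is a ribbon: each box has at most one predecessor (its left or its lower neighbour) and at most
-- one successor.  Under x₁ ↦ t, x_{i≥2} ↦ 0 only the entries 1′ and 1 survive, and semistandardness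
-- forces the entry of every box that has a predecessor: 1 if the predecessor is on its left, 1′ if
-- it is below.  What is free is the entry of the first box of each ribbon and, for every box,
-- whether it continues the bar of its predecessor; that is allowed exactly when their entries agree:
-- always for a box going straight, never at a turn (the forced boxes), and at the second box of a
-- ribbon depending on the first entry.  Hence the sum factorises over boxes: 2t for an isolated box,
-- t(2t − β) for the first two boxes of a ribbon, t − β for each further straight box and t for each
-- turn, and res − 2 is the number of straight boxes.

module Submission where

open import Defs
open import Data.Bool using (Bool; true; false; _∧_; _∨_; not; if_then_else_; T)
import Data.Bool.Properties as Boolₚ
open import Data.Bool.ListAction using (any; or)
open import Data.Empty using (⊥; ⊥-elim)
open import Data.Integer using (ℤ; +_; _+_; _-_; _*_; _^_; -_; 0ℤ; 1ℤ)
import Data.Integer.Properties as ℤₚ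
open import Algebra.Properties.CommutativeSemigroup ℤₚ.*-commutativeSemigroup using (x∙yz≈y∙xz)
open import Data.Integer.Tactic.RingSolver using (solve-∀)
open import Data.List using (List; []; _∷_; length; map; concatMap; upTo; applyUpTo; drop; foldr; _++_)
open import Data.List.Properties using (length-++; length-map; length-upTo; map-applyUpTo; map-cong)
open import Data.List.Membership.Propositional using (_∈_; find; lose)
open import Data.List.Membership.Propositional.Properties using (∈-map⁻; ∈-map⁺; ∈-concatMap⁻; ∈-concatMap⁺; ∈-upTo⁺; ∈-upTo⁻)
open import Data.List.Relation.Binary.Subset.Propositional using (_⊆_)
open import Data.List.Relation.Unary.All as All using (All; all?; []; _∷_)
import Data.List.Relation.Unary.All.Properties as Allₚ
open import Data.List.Relation.Unary.AllPairs as AllPairs using (AllPairs; []; _∷_)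
import Data.List.Relation.Unary.AllPairs.Properties as AllPairsₚ
open import Data.List.Relation.Unary.Any using (Any; here; there)
open import Data.List.Relation.Unary.Linked using (Linked; _∷_)
open import Data.List.Relation.Unary.Unique.Propositional using (Unique)
import Data.List.Relation.Unary.Unique.Propositional.Properties as Uniqueₚ
open import Data.Nat as ℕ using (ℕ; zero; suc; _≤_; _<_; z≤n; s≤s; _∸_; _≤ᵇ_; _<ᵇ_)
import Data.Nat.Properties as ℕₚ
open import Data.Nat.DivMod using (m/n≡1+[m∸n]/n)
open import Data.Nat.ListAction using (sum)
open import Data.Product using (Σ; ∃; _×_; _,_; proj₁; proj₂; uncurry)
open import Data.Product.Properties using () renaming (≡-dec to ×-≡-dec)
open import Data.Sum using (_⊎_; inj₁; inj₂; [_,_]′)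
open import Function using (_∘_; Equivalence)
open import Relation.Binary.Definitions using (DecidableEquality; tri<; tri≈; tri>)
open import Relation.Binary.PropositionalEquality using (_≡_; _≢_; refl; sym; trans; cong; cong₂; subst; subst₂; module ≡-Reasoning)
open import Relation.Nullary using (¬_; Dec; yes; no; does)
open import Relation.Nullary.Decidable using (dec-true; dec-false; map′; _⊎-dec_)

true≢false : true ≡ false → ⊥
true≢false ()

true-or-false : (x : Bool) → x ≡ true ⊎ x ≡ false
true-or-false true  = inj₁ refl
true-or-false false = inj₂ refl

≢true⇒≡false : ∀ {x} → x ≢ true → x ≡ false
≢true⇒≡false = Boolₚ.¬-not

∨-true⁺ˡ : ∀ {a} b → a ≡ true → a ∨ b ≡ true
∨-true⁺ˡ b refl = refl

∨-true⁺ʳ : ∀ a {b} → b ≡ true → a ∨ b ≡ true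
∨-true⁺ʳ a refl = Boolₚ.∨-zeroʳ a

∨-false⁻ : ∀ {a b} → a ∨ b ≡ false → a ≡ false × b ≡ false
∨-false⁻ {a} {b} e = Boolₚ.∨-conicalˡ a b e , Boolₚ.∨-conicalʳ a b e

∨-shuffle : ∀ r l d u → r ∨ (l ∨ (d ∨ (u ∨ false))) ≡ (l ∨ d) ∨ (r ∨ u)
∨-shuffle true  l d u = sym (Boolₚ.∨-zeroʳ (l ∨ d))
∨-shuffle false l d u = trans (cong (λ x → l ∨ (d ∨ x)) (Boolₚ.∨-identityʳ u)) (sym (Boolₚ.∨-assoc l d u))

∧-true⁻ : ∀ {a b} → a ∧ b ≡ true → a ≡ true × b ≡ true
∧-true⁻ {a} {b} e = Boolₚ.∧-conicalˡ a b e , Boolₚ.∧-conicalʳ a b e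

∧-true⁺ : ∀ {a b} → a ≡ true → b ≡ true → a ∧ b ≡ true
∧-true⁺ refl refl = refl

if-true : ∀ {A : Set} {c} (x y : A) → c ≡ true → (if c then x else y) ≡ x
if-true x y refl = refl

if-false : ∀ {A : Set} {c} (x y : A) → c ≡ false → (if c then x else y) ≡ y
if-false x y refl = refl

T⇒≡true : ∀ {x} → T x → x ≡ true
T⇒≡true = Equivalence.to Boolₚ.T-≡

≡true⇒T : ∀ {x} → x ≡ true → T x
≡true⇒T = Equivalence.from Boolₚ.T-≡

does≡true⇒ : ∀ {P : Set} (d : Dec P) → does d ≡ true → P
does≡true⇒ (yes p) _ = p

≤ᵇ⇒≤ : ∀ {m n} → (m ≤ᵇ n) ≡ true → m ≤ n
≤ᵇ⇒≤ {m} {n} e = ℕₚ.≤ᵇ⇒≤ m n (≡true⇒T e)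

<ᵇ⇒< : ∀ {m n} → (m <ᵇ n) ≡ true → m < n
<ᵇ⇒< {m} {n} e = ℕₚ.<ᵇ⇒< m n (≡true⇒T e)

module _ {A : Set} where

  remove : {y : A} (ys : List A) → y ∈ ys → List A
  remove (_ ∷ ys) (here _)  = ys
  remove (x ∷ ys) (there p) = x ∷ remove ys p

  length-remove : {y : A} (ys : List A) (p : y ∈ ys) → length ys ≡ suc (length (remove ys p))
  length-remove (_ ∷ ys) (here _)  = refl
  length-remove (x ∷ ys) (there p) = cong suc (length-remove ys p)

  ∈-remove : {y z : A} (ys : List A) (p : y ∈ ys) → z ∈ ys → z ≢ y → z ∈ remove ys p
  ∈-remove (x ∷ ys) (here refl) (here refl) z≢y = ⊥-elim (z≢y refl)
  ∈-remove (x ∷ ys) (here refl) (there q)   _   = q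
  ∈-remove (x ∷ ys) (there p)   (here refl) _   = here refl
  ∈-remove (x ∷ ys) (there p)   (there q)   z≢y = there (∈-remove ys p q z≢y)

  Unique-⊆⇒length≤ : (xs ys : List A) → Unique xs → xs ⊆ ys → length xs ≤ length ys
  Unique-⊆⇒length≤ []       ys _          _    = z≤n
  Unique-⊆⇒length≤ (x ∷ xs) ys (x∉ ∷ uxs) xs⊆ys =
    subst (suc (length xs) ≤_) (sym (length-remove ys x∈ys))
      (s≤s (Unique-⊆⇒length≤ xs (remove ys x∈ys) uxs
              (λ z∈xs → ∈-remove ys x∈ys (xs⊆ys (there z∈xs)) (λ z≡x → All.lookup x∉ z∈xs (sym z≡x)))))
    where
    x∈ys : x ∈ ys
    x∈ys = xs⊆ys (here refl)

  Unique-⊆-⊇⇒length≡ : (xs ys : List A) → Unique xs → Unique ys → xs ⊆ ys → ys ⊆ xs → length xs ≡ length ys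
  Unique-⊆-⊇⇒length≡ xs ys uxs uys xs⊆ys ys⊆xs =
    ℕₚ.≤-antisym (Unique-⊆⇒length≤ xs ys uxs xs⊆ys) (Unique-⊆⇒length≤ ys xs uys ys⊆xs)

  AllPairs-zipWith-All : {R R′ : A → A → Set} {P : A → Set} {xs : List A} → AllPairs R xs → All P xs →
                         (∀ {x y} → P x → P y → R x y → R′ x y) → AllPairs R′ xs
  AllPairs-zipWith-All []       []       _ = []
  AllPairs-zipWith-All (r ∷ rs) (p ∷ ps) h = All.zipWith (λ (q , r′) → h p q r′) (ps , r) ∷ AllPairs-zipWith-All rs ps h

  ∈-filterB⁻ : (p : A → Bool) (xs : List A) {x : A} → x ∈ filterB p xs → x ∈ xs × p x ≡ true
  ∈-filterB⁻ p (y ∷ xs) x∈ with p y in py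
  ∈-filterB⁻ p (y ∷ xs) (here refl) | true  = here refl , py
  ∈-filterB⁻ p (y ∷ xs) (there x∈)  | true  = let x∈xs , px = ∈-filterB⁻ p xs x∈ in there x∈xs , px
  ∈-filterB⁻ p (y ∷ xs) x∈          | false = let x∈xs , px = ∈-filterB⁻ p xs x∈ in there x∈xs , px

  ∈-filterB⁺ : (p : A → Bool) (xs : List A) {x : A} → x ∈ xs → p x ≡ true → x ∈ filterB p xs
  ∈-filterB⁺ p (y ∷ xs) (here refl) px rewrite px = here refl
  ∈-filterB⁺ p (y ∷ xs) (there x∈) px with p y
  ... | true  = there (∈-filterB⁺ p xs x∈ px)
  ... | false = ∈-filterB⁺ p xs x∈ px

  filterB-Unique : (p : A → Bool) (xs : List A) → Unique xs → Unique (filterB p xs)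
  filterB-Unique p []       []         = []
  filterB-Unique p (y ∷ xs) (y∉ ∷ uxs) with p y
  ... | true  = All.tabulate (λ x∈ → All.lookup y∉ (proj₁ (∈-filterB⁻ p xs x∈))) ∷ filterB-Unique p xs uxs
  ... | false = filterB-Unique p xs uxs

  filterB-cong : (p q : A → Bool) (xs : List A) → (∀ x → x ∈ xs → p x ≡ q x) → filterB p xs ≡ filterB q xs
  filterB-cong p q []       _   = refl
  filterB-cong p q (y ∷ xs) p≗q with p y | q y | p≗q y (here refl)
  ... | true  | true  | _ = cong (y ∷_) (filterB-cong p q xs (λ x x∈ → p≗q x (there x∈)))
  ... | false | false | _ = filterB-cong p q xs (λ x x∈ → p≗q x (there x∈))

  length-filterB-split : (p : A → Bool) (xs : List A) →
                         length (filterB p xs) ℕ.+ length (filterB (λ x → not (p x)) xs) ≡ length xs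
  length-filterB-split p []       = refl
  length-filterB-split p (y ∷ xs) with p y
  ... | true  = cong suc (length-filterB-split p xs)
  ... | false = trans (ℕₚ.+-suc _ _) (cong suc (length-filterB-split p xs))

module _ {A : Set} where

  -- Written with foldr so that sumTerms and monoAt of Defs are literally instances.
  sumBy prodBy : (A → ℤ) → List A → ℤ
  sumBy  g = foldr (λ x acc → g x + acc) 0ℤ
  prodBy g = foldr (λ x acc → g x * acc) 1ℤ

  sumBy-++ : (g : A → ℤ) (xs ys : List A) → sumBy g (xs ++ ys) ≡ sumBy g xs + sumBy g ys
  sumBy-++ g []       ys = sym (ℤₚ.+-identityˡ _)
  sumBy-++ g (x ∷ xs) ys = trans (cong (_+_ (g x)) (sumBy-++ g xs ys)) (sym (ℤₚ.+-assoc (g x) _ _))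

  sumBy-cong : {g h : A → ℤ} (xs : List A) → (∀ {x} → x ∈ xs → g x ≡ h x) → sumBy g xs ≡ sumBy h xs
  sumBy-cong []       _   = refl
  sumBy-cong (x ∷ xs) g≗h = cong₂ _+_ (g≗h (here refl)) (sumBy-cong xs (λ x∈ → g≗h (there x∈)))

  prodBy-cong : {g h : A → ℤ} (xs : List A) → (∀ {x} → x ∈ xs → g x ≡ h x) → prodBy g xs ≡ prodBy h xs
  prodBy-cong []       _   = refl
  prodBy-cong (x ∷ xs) g≗h = cong₂ _*_ (g≗h (here refl)) (prodBy-cong xs (λ x∈ → g≗h (there x∈)))

  sumBy-*ˡ : (c : ℤ) (g : A → ℤ) (xs : List A) → sumBy (λ x → c * g x) xs ≡ c * sumBy g xs
  sumBy-*ˡ c g []       = sym (ℤₚ.*-zeroʳ c)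
  sumBy-*ˡ c g (x ∷ xs) = trans (cong (_+_ (c * g x)) (sumBy-*ˡ c g xs)) (sym (ℤₚ.*-distribˡ-+ c (g x) _))

  sumBy-*ʳ : (c : ℤ) (g : A → ℤ) (xs : List A) → sumBy (λ x → g x * c) xs ≡ sumBy g xs * c
  sumBy-*ʳ c g []       = sym (ℤₚ.*-zeroˡ c)
  sumBy-*ʳ c g (x ∷ xs) = trans (cong (_+_ (g x * c)) (sumBy-*ʳ c g xs)) (sym (ℤₚ.*-distribʳ-+ c (g x) _))

module _ {A B : Set} where

  sumBy-map : (g : B → ℤ) (k : A → B) (xs : List A) → sumBy g (map k xs) ≡ sumBy (λ x → g (k x)) xs
  sumBy-map g k []       = refl
  sumBy-map g k (x ∷ xs) = cong (_+_ (g (k x))) (sumBy-map g k xs)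

  sumBy-concatMap : (g : B → ℤ) (h : A → List B) (xs : List A) →
                    sumBy g (concatMap h xs) ≡ sumBy (λ x → sumBy g (h x)) xs
  sumBy-concatMap g h []       = refl
  sumBy-concatMap g h (x ∷ xs) =
    trans (sumBy-++ g (h x) (concatMap h xs)) (cong (_+_ (sumBy g (h x))) (sumBy-concatMap g h xs))

prodBy-if : {A : Set} (p : A → Bool) (x y : ℤ) (xs : List A) →
            prodBy (λ a → if p a then x else y) xs ≡ x ^ length (filterB p xs) * y ^ length (filterB (λ a → not (p a)) xs)
prodBy-if p x y []       = refl
prodBy-if p x y (a ∷ xs) with p a
... | true  = trans (cong (x *_) (prodBy-if p x y xs)) (sym (ℤₚ.*-assoc x _ _))
... | false = trans (cong (y *_) (prodBy-if p x y xs)) (x∙yz≈y∙xz y (x ^ length (filterB p xs)) _)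

prodBy-zero : {A : Set} (g : A → ℤ) {x : A} {xs : List A} → x ∈ xs → g x ≡ 0ℤ → prodBy g xs ≡ 0ℤ
prodBy-zero g {xs = _ ∷ xs} (here refl) gx≡0 = trans (cong (_* prodBy g xs) gx≡0) (ℤₚ.*-zeroˡ (prodBy g xs))
prodBy-zero g {xs = y ∷ _}  (there x∈)  gx≡0 = trans (cong (g y *_) (prodBy-zero g x∈ gx≡0)) (ℤₚ.*-zeroʳ (g y))

module Choices {A B : Set} (_≟_ : DecidableEquality A) (options : A → List B) (default : B) where

  update : A → B → (A → B) → A → B
  update x o f y = if does (y ≟ x) then o else f y

  update-same : ∀ x o f → update x o f x ≡ o
  update-same x o f rewrite dec-true (x ≟ x) refl = refl

  update-other : ∀ x o f {y} → y ≢ x → update x o f y ≡ f y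
  update-other x o f {y} y≢x rewrite dec-false (y ≟ x) y≢x = refl

  choices : List A → List (A → B)
  choices []       = (λ _ → default) ∷ []
  choices (x ∷ xs) = concatMap (λ o → map (update x o) (choices xs)) (options x)

  ∈-choices⁻ : ∀ {xs f} → Unique xs → f ∈ choices xs → ∀ {x} → x ∈ xs → f x ∈ options x
  ∈-choices⁻ {x₀ ∷ xs} (x₀∉ ∷ uxs) f∈ x∈
    with find (∈-concatMap⁻ (λ o → map (update x₀ o) (choices xs)) {xs = options x₀} f∈)
  ... | o , o∈ , f∈′ with ∈-map⁻ (update x₀ o) f∈′
  ... | g , g∈ , refl with x∈
  ...   | here refl = subst (_∈ options _) (sym (update-same x₀ o g)) o∈
  ...   | there x∈′ = subst (_∈ options _) (sym (update-other x₀ o g (λ x≡x₀ → All.lookup x₀∉ x∈′ (sym x≡x₀))))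
                        (∈-choices⁻ uxs g∈ x∈′)

  ∈-choices⁺ : ∀ {xs} → Unique xs → (h : A → B) → (∀ {x} → x ∈ xs → h x ∈ options x) →
               ∃ λ f → f ∈ choices xs × (∀ {x} → x ∈ xs → f x ≡ h x)
  ∈-choices⁺ {[]}      _            h _   = _ , here refl , λ ()
  ∈-choices⁺ {x₀ ∷ xs} (x₀∉ ∷ uxs) h h∈ with ∈-choices⁺ uxs h (λ x∈ → h∈ (there x∈))
  ... | g , g∈ , g≗h =
    update x₀ (h x₀) g ,
    ∈-concatMap⁺ (λ o → map (update x₀ o) (choices xs)) {xs = options x₀}
                 (lose (h∈ (here refl)) (∈-map⁺ (update x₀ (h x₀)) g∈)) ,
    agree
    where
    agree : ∀ {x} → x ∈ x₀ ∷ xs → update x₀ (h x₀) g x ≡ h x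
    agree (here refl) = update-same x₀ (h x₀) g
    agree (there x∈)  = trans (update-other x₀ (h x₀) g (λ x≡x₀ → All.lookup x₀∉ x∈ (sym x≡x₀))) (g≗h x∈)

  DifferOn : List A → (A → B) → (A → B) → Set
  DifferOn xs f g = ∃ λ x → x ∈ xs × f x ≢ g x

  choices-differ : (∀ x → Unique (options x)) → ∀ {xs} → Unique xs → AllPairs (DifferOn xs) (choices xs)
  choices-differ uopts {[]}      _            = [] ∷ []
  choices-differ uopts {x₀ ∷ xs} (x₀∉ ∷ uxs) = blocks (options x₀) (uopts x₀)
    where
    extend : ∀ o {g g′} → DifferOn xs g g′ → DifferOn (x₀ ∷ xs) (update x₀ o g) (update x₀ o g′)
    extend o {g} {g′} (x , x∈ , gx≢g′x) = x , there x∈ , λ e →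
      gx≢g′x (trans (sym (update-other x₀ o g x≢x₀)) (trans e (update-other x₀ o g′ x≢x₀)))
      where
      x≢x₀ : x ≢ x₀
      x≢x₀ x≡x₀ = All.lookup x₀∉ x∈ (sym x≡x₀)
    block : B → List (A → B)
    block o = map (update x₀ o) (choices xs)
    blocks : ∀ os → Unique os → AllPairs (DifferOn (x₀ ∷ xs)) (concatMap block os)
    blocks []       _          = []
    blocks (o ∷ os) (o∉ ∷ uos) =
      AllPairsₚ.++⁺ (AllPairsₚ.map⁺ (AllPairs.map (extend o) (choices-differ uopts uxs))) (blocks os uos)
        (All.tabulate λ f∈ → All.tabulate λ f′∈ → across f∈ f′∈)
      where
      across : ∀ {f f′} → f ∈ block o → f′ ∈ concatMap block os → DifferOn (x₀ ∷ xs) f f′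
      across f∈ f′∈ with ∈-map⁻ (update x₀ o) f∈ | find (∈-concatMap⁻ block {xs = os} f′∈)
      ... | g , _ , refl | o′ , o′∈ , f′∈′ with ∈-map⁻ (update x₀ o′) f′∈′
      ...   | g′ , _ , refl = x₀ , here refl ,
              λ e → All.lookup o∉ o′∈ (trans (sym (update-same x₀ o g)) (trans e (update-same x₀ o′ g′)))

  sum-choices-prod : (w : A → B → ℤ) → ∀ {xs} → Unique xs →
    sumBy (λ f → prodBy (λ x → w x (f x)) xs) (choices xs) ≡ prodBy (λ x → sumBy (w x) (options x)) xs
  sum-choices-prod w {[]}      _            = ℤₚ.+-identityʳ 1ℤ
  sum-choices-prod w {x₀ ∷ xs} (x₀∉ ∷ uxs) = begin
    sumBy weight (concatMap (λ o → map (update x₀ o) (choices xs)) (options x₀))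
      ≡⟨ sumBy-concatMap weight (λ o → map (update x₀ o) (choices xs)) (options x₀) ⟩
    sumBy (λ o → sumBy weight (map (update x₀ o) (choices xs))) (options x₀)
      ≡⟨ sumBy-cong (options x₀) (λ {o} _ → block o) ⟩
    sumBy (λ o → w x₀ o * rest) (options x₀)
      ≡⟨ sumBy-*ʳ rest (w x₀) (options x₀) ⟩
    sumBy (w x₀) (options x₀) * rest ∎
    where
    open ≡-Reasoning
    weight : (A → B) → ℤ
    weight f = prodBy (λ x → w x (f x)) (x₀ ∷ xs)
    rest : ℤ
    rest = prodBy (λ x → sumBy (w x) (options x)) xs
    block : ∀ o → sumBy weight (map (update x₀ o) (choices xs)) ≡ w x₀ o * rest
    block o = begin
      sumBy weight (map (update x₀ o) (choices xs))
        ≡⟨ sumBy-map weight (update x₀ o) (choices xs) ⟩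
      sumBy (λ g → weight (update x₀ o g)) (choices xs)
        ≡⟨ sumBy-cong (choices xs) (λ {g} _ → cong₂ _*_ (cong (w x₀) (update-same x₀ o g))
             (prodBy-cong xs (λ {x} x∈ → cong (w x) (update-other x₀ o g (λ x≡x₀ → All.lookup x₀∉ x∈ (sym x≡x₀)))))) ⟩
      sumBy (λ g → w x₀ o * prodBy (λ x → w x (g x)) xs) (choices xs)
        ≡⟨ sumBy-*ˡ (w x₀ o) (λ g → prodBy (λ x → w x (g x)) xs) (choices xs) ⟩
      w x₀ o * sumBy (λ g → prodBy (λ x → w x (g x)) xs) (choices xs)
        ≡⟨ cong (w x₀ o *_) (sum-choices-prod w uxs) ⟩
      w x₀ o * rest ∎

rowEnd : List ℕ → ℕ → ℕ
rowEnd λs i = i ℕ.+ part λs i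

record InSD (λs : List ℕ) (i j : ℕ) : Set where
  constructor inSD-bounds
  field
    row≥1   : 1 ≤ i
    row≤ℓ   : i ≤ length λs
    diag≤   : i ≤ j
    <rowEnd : j < rowEnd λs i

inSD⇒InSD : ∀ λs i j → inSD λs (i , j) ≡ true → InSD λs i j
inSD⇒InSD λs i j e =
  let a , e₁ = ∧-true⁻ {1 ≤ᵇ i} e
      b , e₂ = ∧-true⁻ {i ≤ᵇ length λs} e₁
      c , d  = ∧-true⁻ {i ≤ᵇ j} e₂
  in inSD-bounds (≤ᵇ⇒≤ a) (≤ᵇ⇒≤ b) (≤ᵇ⇒≤ c) (<ᵇ⇒< d)

InSD⇒inSD : ∀ {λs i j} → InSD λs i j → inSD λs (i , j) ≡ true
InSD⇒inSD (inSD-bounds a b c d) =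
  ∧-true⁺ (T⇒≡true (ℕₚ.≤⇒≤ᵇ a)) (∧-true⁺ (T⇒≡true (ℕₚ.≤⇒≤ᵇ b))
    (∧-true⁺ (T⇒≡true (ℕₚ.≤⇒≤ᵇ c)) (T⇒≡true (ℕₚ.<⇒<ᵇ d))))

inSD-drop : ∀ λs i j → inSD λs (suc (suc i) , suc j) ≡ inSD (drop 1 λs) (suc i , j)
inSD-drop []       i j = refl
inSD-drop (_ ∷ _)  i j = refl

InSD-left : ∀ {λs i j k} → InSD λs i k → i ≤ j → j ≤ k → InSD λs i j
InSD-left (inSD-bounds a b _ d) i≤j j≤k = inSD-bounds a b i≤j (ℕₚ.≤-<-trans j≤k d)

module _ {λs : List ℕ} (decreasing : Linked (λ a b → b < a) λs) where

  part-suc< : ∀ a → 1 ≤ a → suc a ≤ length λs → part λs (suc a) < part λs a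
  part-suc< a 1≤a a<ℓ = go λs decreasing a 1≤a a<ℓ
    where
    go : ∀ μs → Linked (λ a b → b < a) μs → ∀ a → 1 ≤ a → suc a ≤ length μs → part μs (suc a) < part μs a
    go (x ∷ y ∷ ys) (y<x ∷ _) (suc zero)    _ _         = y<x
    go (x ∷ y ∷ ys) (_ ∷ l)   (suc (suc a)) _ (s≤s a<ℓ) = go (y ∷ ys) l (suc a) (s≤s z≤n) a<ℓ
    go (x ∷ [])     _         (suc _)       _ (s≤s ())

  rowEnd-suc≤ : ∀ a → 1 ≤ a → suc a ≤ length λs → rowEnd λs (suc a) ≤ rowEnd λs a
  rowEnd-suc≤ a 1≤a a<ℓ =
    subst (_≤ rowEnd λs a) (ℕₚ.+-suc a (part λs (suc a))) (ℕₚ.+-monoʳ-≤ a (part-suc< a 1≤a a<ℓ))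

  rowEnd-antitone : ∀ {a} b → 1 ≤ a → a ≤ b → b ≤ length λs → rowEnd λs b ≤ rowEnd λs a
  rowEnd-antitone zero    (s≤s _) () _
  rowEnd-antitone (suc b) 1≤a a≤b+1 b<ℓ with ℕₚ.m≤n⇒m<n∨m≡n a≤b+1
  ... | inj₂ refl        = ℕₚ.≤-refl
  ... | inj₁ (s≤s a≤b) =
    ℕₚ.≤-trans (rowEnd-suc≤ b (ℕₚ.≤-trans 1≤a a≤b) b<ℓ) (rowEnd-antitone b 1≤a a≤b (ℕₚ.<⇒≤ b<ℓ))


  InSD-up : ∀ {i j} → InSD λs (suc i) j → 1 ≤ i → i ≤ j → InSD λs i j
  InSD-up {i} (inSD-bounds _ b _ d) 1≤i i≤j =
    inSD-bounds 1≤i (ℕₚ.<⇒≤ b) i≤j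
      (ℕₚ.<-≤-trans d (rowEnd-antitone (suc i) 1≤i (ℕₚ.n≤1+n i) b))

  InSD-column-step : ∀ {i i′ j} → InSD λs i j → InSD λs i′ j → i < i′ → InSD λs (suc i) j
  InSD-column-step {i} {i′} (inSD-bounds _ _ c _) (inSD-bounds _ b′ c′ d′) i<i′ =
    inSD-bounds (s≤s z≤n) (ℕₚ.≤-trans i<i′ b′) (ℕₚ.≤-trans i<i′ c′)
      (ℕₚ.<-≤-trans d′ (rowEnd-antitone i′ (s≤s z≤n) i<i′ b′))

rowBoxes : List ℕ → ℕ → List Box
rowBoxes λs i = map (λ k → (i , i ℕ.+ k)) (upTo (part λs i))

rowIndices : List ℕ → List ℕ
rowIndices λs = map suc (upTo (length λs))

∈-sdBoxes⁻ : ∀ λs {b} → b ∈ sdBoxes λs → inSD λs b ≡ true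
∈-sdBoxes⁻ λs b∈ with find (∈-concatMap⁻ (rowBoxes λs) {xs = rowIndices λs} b∈)
... | i , i∈ , b∈row with ∈-map⁻ suc i∈ | ∈-map⁻ (λ k → (i , i ℕ.+ k)) b∈row
... | i₀ , i₀∈ , refl | k , k∈ , refl =
  InSD⇒inSD {λs} (inSD-bounds (s≤s z≤n) (∈-upTo⁻ i₀∈) (ℕₚ.m≤m+n _ k) (ℕₚ.+-monoʳ-< (suc i₀) (∈-upTo⁻ k∈)))

∈-sdBoxes⁺ : ∀ λs {b} → inSD λs b ≡ true → b ∈ sdBoxes λs
∈-sdBoxes⁺ λs {i , j} e with inSD⇒InSD λs i j e
... | inSD-bounds (s≤s {n = i₀} z≤n) i≤ℓ i≤j j<end =
  ∈-concatMap⁺ (rowBoxes λs) (lose (∈-map⁺ suc (∈-upTo⁺ i≤ℓ))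
    (subst (λ z → (i , z) ∈ rowBoxes λs i) i+k≡j (∈-map⁺ (λ k → (i , i ℕ.+ k)) (∈-upTo⁺ k<part))))
  where
  k : ℕ
  k = j ∸ i
  i+k≡j : i ℕ.+ k ≡ j
  i+k≡j = ℕₚ.m+[n∸m]≡n i≤j
  k<part : k < part λs i
  k<part = ℕₚ.+-cancelˡ-< i k (part λs i) (subst (_< rowEnd λs i) (sym i+k≡j) j<end)

sdBoxes-Unique : ∀ λs → Unique (sdBoxes λs)
sdBoxes-Unique λs = rows (rowIndices λs) (Uniqueₚ.map⁺ ℕₚ.suc-injective (Uniqueₚ.upTo⁺ (length λs)))
  where
  rowBoxes-Unique : ∀ i → Unique (rowBoxes λs i)
  rowBoxes-Unique i = Uniqueₚ.map⁺ (λ e → ℕₚ.+-cancelˡ-≡ i _ _ (cong proj₂ e)) (Uniqueₚ.upTo⁺ (part λs i))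
  row-of : ∀ {i b} → b ∈ rowBoxes λs i → proj₁ b ≡ i
  row-of {i} b∈ = let _ , _ , e = ∈-map⁻ (λ k → (i , i ℕ.+ k)) b∈ in cong proj₁ e
  rows : ∀ is → Unique is → Unique (concatMap (rowBoxes λs) is)
  rows []       _          = []
  rows (i ∷ is) (i∉ ∷ uis) =
    AllPairsₚ.++⁺ (rowBoxes-Unique i) (rows is uis)
      (All.tabulate λ b∈ → All.tabulate λ c∈ b≡c →
         let i′ , i′∈ , c∈′ = find (∈-concatMap⁻ (rowBoxes λs) {xs = is} c∈)
         in All.lookup i∉ i′∈ (trans (sym (row-of b∈)) (trans (cong proj₁ b≡c) (row-of c∈′))))

length-sdBoxes : ∀ λs → length (sdBoxes λs) ≡ sum λs
length-sdBoxes λs = begin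
  length (concatMap (rowBoxes λs) (rowIndices λs))  ≡⟨ length-rows (rowIndices λs) ⟩
  sum (map (part λs) (map suc (upTo (length λs))))  ≡⟨ cong (sum ∘ map (part λs)) (map-applyUpTo (λ i → i) suc (length λs)) ⟩
  sum (map (part λs) (applyUpTo suc (length λs)))   ≡⟨ cong sum (map-applyUpTo suc (part λs) (length λs)) ⟩
  sum (applyUpTo (part λs ∘ suc) (length λs))       ≡⟨ sum-parts λs ⟩
  sum λs                                            ∎
  where
  open ≡-Reasoning
  length-rows : ∀ is → length (concatMap (rowBoxes λs) is) ≡ sum (map (part λs) is)
  length-rows []       = refl
  length-rows (i ∷ is) = trans (length-++ (rowBoxes λs i))
    (cong₂ ℕ._+_ (trans (length-map _ (upTo (part λs i))) (length-upTo _)) (length-rows is))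
  sum-parts : ∀ μs → sum (applyUpTo (part μs ∘ suc) (length μs)) ≡ sum μs
  sum-parts []       = refl
  sum-parts (x ∷ xs) = cong (x ℕ.+_) (sum-parts xs)

eqBox⇒≡ : ∀ a b → eqBox a b ≡ true → a ≡ b
eqBox⇒≡ (a₁ , a₂) (b₁ , b₂) e =
  let d₁ , d₂ = ∧-true⁻ {does (a₁ ℕₚ.≟ b₁)} e
  in cong₂ _,_ (ℕₚ.≡ᵇ⇒≡ a₁ b₁ (≡true⇒T d₁)) (ℕₚ.≡ᵇ⇒≡ a₂ b₂ (≡true⇒T d₂))

≡⇒eqBox : ∀ a b → a ≡ b → eqBox a b ≡ true
≡⇒eqBox (a₁ , a₂) _ refl rewrite dec-true (a₁ ℕₚ.≟ a₁) refl | dec-true (a₂ ℕₚ.≟ a₂) refl = refl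

≢⇒eqBox : ∀ a b → a ≢ b → eqBox a b ≡ false
≢⇒eqBox a b a≢b = ≢true⇒≡false (λ e → a≢b (eqBox⇒≡ a b e))

eqBox-cong : ∀ a b a′ b′ → (a ≡ b → a′ ≡ b′) → (a′ ≡ b′ → a ≡ b) → eqBox a b ≡ eqBox a′ b′
eqBox-cong a b a′ b′ to from with eqBox a b in e | eqBox a′ b′ in e′
... | true  | true  = refl
... | false | false = refl
... | true  | false = ⊥-elim (true≢false (trans (sym (≡⇒eqBox a′ b′ (to (eqBox⇒≡ a b e)))) e′))
... | false | true  = ⊥-elim (true≢false (trans (sym (≡⇒eqBox a b (from (eqBox⇒≡ a′ b′ e′)))) e))

record IsRibbonShape (S : Box → Bool) : Set where
  field
    shifted     : ∀ i j → S (i , j) ≡ true → 1 ≤ i × i ≤ j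
    no-diagonal : ∀ i j → S (i , j) ≡ true → S (suc i , suc j) ≡ true → ⊥
    row-convex  : ∀ i j j′ k → S (i , j) ≡ true → S (i , j′) ≡ true → j ≤ k → k ≤ j′ → S (i , k) ≡ true
    column-step : ∀ i i′ j → S (i , j) ≡ true → S (i′ , j) ≡ true → i < i′ → S (suc i , j) ≡ true

module _ (λs μs : List ℕ) where

  Sk⇒ : ∀ i j → Sk λs μs (i , j) → InSD λs i j × (InSD μs i j → ⊥)
  Sk⇒ i j s =
    let inλ , notInμ = ∧-true⁻ {inSD λs (i , j)} s
    in inSD⇒InSD λs i j inλ , λ inμ → Boolₚ.not-¬ (InSD⇒inSD inμ) (Boolₚ.not-injective notInμ)

  ⇒Sk : ∀ i j → InSD λs i j → (InSD μs i j → ⊥) → Sk λs μs (i , j)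
  ⇒Sk i j inλ notInμ =
    ∧-true⁺ (InSD⇒inSD inλ) (cong not (Boolₚ.¬-not (λ e → notInμ (inSD⇒InSD μs i j e))))

  skew-isRibbonShape : Linked (λ a b → b < a) λs → Linked (λ a b → b < a) μs → drop 1 λs ⊆SD μs →
                       IsRibbonShape (skew λs μs)
  skew-isRibbonShape decλ decμ Γ⊆μ = record
    { shifted     = λ i j s → let inSD-bounds a _ c _ = proj₁ (Sk⇒ i j s) in a , c
    ; no-diagonal = no-diagonal
    ; row-convex  = λ i j j′ k s s′ j≤k k≤j′ →
        let inλ , notInμ = Sk⇒ i j s
            inSD-bounds a b c _ = inλ
            inSD-bounds _ _ _ d = proj₁ (Sk⇒ i j′ s′)
        in ⇒Sk i k (inSD-bounds a b (ℕₚ.≤-trans c j≤k) (ℕₚ.≤-<-trans k≤j′ d))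
               (λ inμ → notInμ (InSD-left inμ c j≤k))
    ; column-step = λ i i′ j s s′ i<i′ →
        let inλ , notInμ = Sk⇒ i j s
            inSD-bounds a _ c _ = inλ
        in ⇒Sk (suc i) j (InSD-column-step decλ inλ (proj₁ (Sk⇒ i′ j s′)) i<i′) (λ inμ → notInμ (InSD-up decμ inμ a c))
    }
    where
    no-diagonal : ∀ i j → Sk λs μs (i , j) → Sk λs μs (suc i , suc j) → ⊥
    no-diagonal zero    j s _  with proj₁ (Sk⇒ zero j s)
    ... | inSD-bounds () _ _ _
    no-diagonal (suc i) j s s′ = proj₂ (Sk⇒ (suc i) j s)
      (inSD⇒InSD μs (suc i) j (Γ⊆μ (suc i , j)
        (trans (sym (inSD-drop λs i j)) (InSD⇒inSD (proj₁ (Sk⇒ (suc (suc i)) (suc j) s′))))))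

  ∈-skewBoxes⁻ : ∀ {b} → b ∈ skewBoxes λs μs → Sk λs μs b
  ∈-skewBoxes⁻ {b} b∈ =
    let b∈λ , notInμ = ∈-filterB⁻ (λ b → not (inSD μs b)) (sdBoxes λs) b∈
    in ∧-true⁺ (∈-sdBoxes⁻ λs b∈λ) notInμ

  ∈-skewBoxes⁺ : ∀ {b} → Sk λs μs b → b ∈ skewBoxes λs μs
  ∈-skewBoxes⁺ {b} s =
    let inλ , notInμ = ∧-true⁻ {inSD λs b} s
    in ∈-filterB⁺ (λ b → not (inSD μs b)) (sdBoxes λs) (∈-sdBoxes⁺ λs inλ) notInμ

  skewBoxes-Unique : Unique (skewBoxes λs μs)
  skewBoxes-Unique = filterB-Unique _ (sdBoxes λs) (sdBoxes-Unique λs)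

  size≡length-skewBoxes : μs ⊆SD λs → size λs μs ≡ length (skewBoxes λs μs)
  size≡length-skewBoxes μ⊆λ = begin
    sum λs ∸ sum μs                                                  ≡⟨ cong₂ _∸_ (sym split) (sym |μ|) ⟩
    length inμ ℕ.+ length (skewBoxes λs μs) ∸ length inμ            ≡⟨ ℕₚ.m+n∸m≡n (length inμ) _ ⟩
    length (skewBoxes λs μs)                                         ∎
    where
    open ≡-Reasoning
    inμ : List Box
    inμ = filterB (inSD μs) (sdBoxes λs)
    split : length inμ ℕ.+ length (skewBoxes λs μs) ≡ sum λs
    split = trans (length-filterB-split (inSD μs) (sdBoxes λs)) (length-sdBoxes λs)
    |μ| : length inμ ≡ sum μs
    |μ| = trans
      (Unique-⊆-⊇⇒length≡ inμ (sdBoxes μs) (filterB-Unique _ (sdBoxes λs) (sdBoxes-Unique λs)) (sdBoxes-Unique μs)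
        (λ b∈ → ∈-sdBoxes⁺ μs (proj₂ (∈-filterB⁻ (inSD μs) (sdBoxes λs) b∈)))
        (λ {b} b∈ → let e = ∈-sdBoxes⁻ μs b∈ in ∈-filterB⁺ (inSD μs) (sdBoxes λs) (∈-sdBoxes⁺ λs (μ⊆λ b e)) e))
      (length-sdBoxes μs)

-- Isolated boxes are the one-box
-- components counted by scc; every longer ribbon has exactly one first and one second box, so
-- mcc counts either; a turn box is one where the ribbon changes direction: the forced boxes of fb.
data BoxType : Set where
  isolated first second straight turn : BoxType

classify : (hasPrev hasPrevPrev fromLeft prevFromLeft hasNext : Bool) → BoxType
classify false _     _     _     false = isolated
classify false _     _     _     true  = first
classify true  false _     _     _     = second
classify true  true  true  true  _     = straight
classify true  true  false false _     = straight
classify true  true  true  false _     = turn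
classify true  true  false true  _     = turn

typeCode : BoxType → ℕ
typeCode isolated = 0
typeCode first    = 1
typeCode second   = 2
typeCode straight = 3
typeCode turn     = 4

typeOfCode : ℕ → BoxType
typeOfCode 0 = isolated
typeOfCode 1 = first
typeOfCode 2 = second
typeOfCode 3 = straight
typeOfCode _ = turn

typeOfCode-typeCode : ∀ k → typeOfCode (typeCode k) ≡ k
typeOfCode-typeCode isolated = refl
typeOfCode-typeCode first    = refl
typeOfCode-typeCode second   = refl
typeOfCode-typeCode straight = refl
typeOfCode-typeCode turn     = refl

_≟ᵗ_ : DecidableEquality BoxType
k ≟ᵗ k′ = map′ injective (cong typeCode) (typeCode k ℕₚ.≟ typeCode k′)
  where
  injective : typeCode k ≡ typeCode k′ → k ≡ k′
  injective e = trans (sym (typeOfCode-typeCode k)) (trans (cong typeOfCode e) (typeOfCode-typeCode k′))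

data Classified (p pp l lp n : Bool) : BoxType → Set where
  isolated : p ≡ false → n ≡ false → Classified p pp l lp n isolated
  first    : p ≡ false → n ≡ true → Classified p pp l lp n first
  second   : p ≡ true → pp ≡ false → Classified p pp l lp n second
  straight : p ≡ true → pp ≡ true → l ≡ lp → Classified p pp l lp n straight
  turn     : p ≡ true → pp ≡ true → l ≢ lp → Classified p pp l lp n turn

classified : ∀ p pp l lp n → Classified p pp l lp n (classify p pp l lp n)
classified false _     _     _     false = isolated refl refl
classified false _     _     _     true  = first refl refl
classified true  false _     _     _     = second refl refl
classified true  true  true  true  _     = straight refl refl refl
classified true  true  false false _     = straight refl refl refl
classified true  true  true  false _     = turn refl refl (λ ())
classified true  true  false true  _     = turn refl refl (λ ())

module _ {p pp l lp n : Bool} where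

  classified-as : ∀ {k} → classify p pp l lp n ≡ k → Classified p pp l lp n k
  classified-as e = subst (Classified p pp l lp n) e (classified p pp l lp n)

  classify-isolated : classify p pp l lp n ≡ isolated → p ≡ false × n ≡ false
  classify-isolated e with classified-as e
  ... | isolated p≡ n≡ = p≡ , n≡

  classify-first : classify p pp l lp n ≡ first → p ≡ false × n ≡ true
  classify-first e with classified-as e
  ... | first p≡ n≡ = p≡ , n≡

  classify-second : classify p pp l lp n ≡ second → p ≡ true × pp ≡ false
  classify-second e with classified-as e
  ... | second p≡ pp≡ = p≡ , pp≡

  classify-straight : classify p pp l lp n ≡ straight → p ≡ true × pp ≡ true × l ≡ lp
  classify-straight e with classified-as e
  ... | straight p≡ pp≡ l≡ = p≡ , pp≡ , l≡

  classify-turn : classify p pp l lp n ≡ turn → p ≡ true × pp ≡ true × l ≢ lp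
  classify-turn e with classified-as e
  ... | turn p≡ pp≡ l≢ = p≡ , pp≡ , l≢

isolated?-classify : ∀ p pp l lp n → does (isolated ≟ᵗ classify p pp l lp n) ≡ not (p ∨ n)
isolated?-classify false _     _     _     false = refl
isolated?-classify false _     _     _     true  = refl
isolated?-classify true  false _     _     _     = refl
isolated?-classify true  true  true  true  _     = refl
isolated?-classify true  true  false false _     = refl
isolated?-classify true  true  true  false _     = refl
isolated?-classify true  true  false true  _     = refl

turn?-classify-noPrev : ∀ pp l lp n → does (turn ≟ᵗ classify false pp l lp n) ≡ false
turn?-classify-noPrev _ _ _ false = refl
turn?-classify-noPrev _ _ _ true  = refl

turn?-classify-fromLeft : ∀ lp dp n → (dp ≡ true → lp ≡ false) → does (turn ≟ᵗ classify true (lp ∨ dp) true lp n) ≡ dp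
turn?-classify-fromLeft true  true  _ excl with () ← excl refl
turn?-classify-fromLeft true  false _ _ = refl
turn?-classify-fromLeft false true  _ _ = refl
turn?-classify-fromLeft false false _ _ = refl

turn?-classify-fromBelow : ∀ lp dp n → does (turn ≟ᵗ classify true (lp ∨ dp) false lp n) ≡ lp
turn?-classify-fromBelow true  _     _ = refl
turn?-classify-fromBelow false true  _ = refl
turn?-classify-fromBelow false false _ = refl

-- Entries are coded 1 for 1′ and 2 for 1.  A choice assigns to each box one of its options:
-- an isolated box picks its entry (0 ↦ 1′, 1 ↦ 1); a straight box joins the bar of its
-- predecessor (1) or not (0); a second box records whether the entry of the first box differs
-- from its own forced entry (0), agrees and starts a new bar (1), or agrees and joins (2).
-- All other entries are forced, and first and turn boxes have a single option.
options : BoxType → List ℕ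
options isolated = 0 ∷ 1 ∷ []
options first    = 0 ∷ []
options second   = 0 ∷ 1 ∷ 2 ∷ []
options straight = 0 ∷ 1 ∷ []
options turn     = 0 ∷ []

options-Unique : ∀ k → Unique (options k)
options-Unique isolated = ((λ ()) ∷ []) ∷ [] ∷ []
options-Unique first    = [] ∷ []
options-Unique second   = ((λ ()) ∷ (λ ()) ∷ []) ∷ ((λ ()) ∷ []) ∷ [] ∷ []
options-Unique straight = ((λ ()) ∷ []) ∷ [] ∷ []
options-Unique turn     = [] ∷ []

joins : BoxType → ℕ → Bool
joins second   2 = true
joins straight 1 = true
joins _        _ = false

joins-second : ∀ o → joins second o ≡ true → o ≡ 2
joins-second 2 _ = refl

ifZero : ℕ → ℕ → ℕ → ℕ
ifZero zero    a _ = a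
ifZero (suc _) _ b = b

matchingEntry otherEntry : Bool → ℕ
matchingEntry true  = 2
matchingEntry false = 1
otherEntry    true  = 1
otherEntry    false = 2

entryOf : (fromLeft fromBelow hasNext : Bool) (nextOption ownOption : ℕ) (nextIsRight : Bool) → ℕ
entryOf true  _     _     _  _ _ = 2
entryOf false true  _     _  _ _ = 1
entryOf false false true  os _ r = ifZero os (otherEntry r) (matchingEntry r)
entryOf false false false _  o _ = ifZero o 1 2

entryOf-fromLeft : ∀ {l d n os o r} → l ≡ true → entryOf l d n os o r ≡ 2
entryOf-fromLeft refl = refl

entryOf-fromBelow : ∀ {l d n os o r} → l ≡ false → d ≡ true → entryOf l d n os o r ≡ 1
entryOf-fromBelow refl refl = refl

entryOf-first : ∀ {l d n os o r} → l ≡ false → d ≡ false → n ≡ true →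
                entryOf l d n os o r ≡ ifZero os (otherEntry r) (matchingEntry r)
entryOf-first refl refl refl = refl

entryOf-isolated : ∀ {l d n os o r} → l ≡ false → d ≡ false → n ≡ false → entryOf l d n os o r ≡ ifZero o 1 2
entryOf-isolated refl refl refl = refl

entryOf-1-or-2 : ∀ l d n os o r → entryOf l d n os o r ≡ 1 ⊎ entryOf l d n os o r ≡ 2
entryOf-1-or-2 true  _     _     _       _       _     = inj₂ refl
entryOf-1-or-2 false true  _     _       _       _     = inj₁ refl
entryOf-1-or-2 false false true  zero    _       true  = inj₁ refl
entryOf-1-or-2 false false true  zero    _       false = inj₂ refl
entryOf-1-or-2 false false true  (suc _) _       true  = inj₂ refl
entryOf-1-or-2 false false true  (suc _) _       false = inj₁ refl
entryOf-1-or-2 false false false _       zero    _     = inj₁ refl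
entryOf-1-or-2 false false false _       (suc _) _     = inj₂ refl

optionOf : BoxType → (entry prevEntry prevMatching : ℕ) (joined : Bool) → ℕ
optionOf isolated 1 _  _  _ = 0
optionOf isolated _ _  _  _ = 1
optionOf first    _ _  _  _ = 0
optionOf second   _ vp mv e = if vp ℕ.≡ᵇ mv then (if e then 2 else 1) else 0
optionOf straight _ _  _  e = if e then 1 else 0
optionOf turn     _ _  _  _ = 0

optionOf-∈ : ∀ k v vp mv e → optionOf k v vp mv e ∈ options k
optionOf-∈ isolated 1             _  _  _ = here refl
optionOf-∈ isolated 0             _  _  _ = there (here refl)
optionOf-∈ isolated (suc (suc _)) _  _  _ = there (here refl)
optionOf-∈ first    _             _  _  _ = here refl
optionOf-∈ second   _             vp mv e with vp ℕ.≡ᵇ mv | e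
... | true  | true  = there (there (here refl))
... | true  | false = there (here refl)
... | false | _     = here refl
optionOf-∈ straight _ _ _ true  = there (here refl)
optionOf-∈ straight _ _ _ false = here refl
optionOf-∈ turn     _ _ _ _     = here refl

joins-optionOf : ∀ k v vp mv e → joins k (optionOf k v vp mv e) ≡ true → e ≡ true
joins-optionOf isolated 1             _  _  _ ()
joins-optionOf isolated 0             _  _  _ ()
joins-optionOf isolated (suc (suc _)) _  _  _ ()
joins-optionOf second   _             vp mv e j with vp ℕ.≡ᵇ mv | e
... | true  | true  = refl
joins-optionOf second _ _ _ _ () | true  | false
joins-optionOf second _ _ _ _ () | false | _
joins-optionOf straight _ _ _ true _ = refl

joins-optionOf-second : ∀ v vp mv e → vp ≡ mv → e ≡ true → joins second (optionOf second v vp mv e) ≡ true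
joins-optionOf-second v vp _ e refl refl rewrite T⇒≡true (ℕₚ.≡⇒≡ᵇ vp vp refl) = refl

optionOf-isolated-cong : ∀ {v v′} vp mv e vp′ mv′ e′ → v ≡ v′ →
                         optionOf isolated v vp mv e ≡ optionOf isolated v′ vp′ mv′ e′
optionOf-isolated-cong {0}           _ _ _ _ _ _ refl = refl
optionOf-isolated-cong {1}           _ _ _ _ _ _ refl = refl
optionOf-isolated-cong {suc (suc _)} _ _ _ _ _ _ refl = refl

ifZero-optionOf-isolated : ∀ v vp mv e → v ≡ 1 ⊎ v ≡ 2 → ifZero (optionOf isolated v vp mv e) 1 2 ≡ v
ifZero-optionOf-isolated _ _ _ _ (inj₁ refl) = refl
ifZero-optionOf-isolated _ _ _ _ (inj₂ refl) = refl

ifZero-optionOf-second : ∀ v vp r e → vp ≡ 1 ⊎ vp ≡ 2 →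
  ifZero (optionOf second v vp (matchingEntry r) e) (otherEntry r) (matchingEntry r) ≡ vp
ifZero-optionOf-second _ _ true  true  (inj₁ refl) = refl
ifZero-optionOf-second _ _ true  false (inj₁ refl) = refl
ifZero-optionOf-second _ _ false true  (inj₁ refl) = refl
ifZero-optionOf-second _ _ false false (inj₁ refl) = refl
ifZero-optionOf-second _ _ true  true  (inj₂ refl) = refl
ifZero-optionOf-second _ _ true  false (inj₂ refl) = refl
ifZero-optionOf-second _ _ false true  (inj₂ refl) = refl
ifZero-optionOf-second _ _ false false (inj₂ refl) = refl

optionOf-isolated-ifZero : ∀ o vp mv e → o ∈ options isolated → optionOf isolated (ifZero o 1 2) vp mv e ≡ o
optionOf-isolated-ifZero _ _ _ _ (here refl)         = refl
optionOf-isolated-ifZero _ _ _ _ (there (here refl)) = refl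

optionOf-second-ifZero : ∀ o v r → o ∈ options second →
  optionOf second v (ifZero o (otherEntry r) (matchingEntry r)) (matchingEntry r) (joins second o) ≡ o
optionOf-second-ifZero _ _ true  (here refl)                 = refl
optionOf-second-ifZero _ _ false (here refl)                 = refl
optionOf-second-ifZero _ _ true  (there (here refl))         = refl
optionOf-second-ifZero _ _ false (there (here refl))         = refl
optionOf-second-ifZero _ _ true  (there (there (here refl))) = refl
optionOf-second-ifZero _ _ false (there (there (here refl))) = refl

optionOf-straight-joins : ∀ o v vp mv → o ∈ options straight → optionOf straight v vp mv (joins straight o) ≡ o
optionOf-straight-joins _ _ _ _ (here refl)         = refl
optionOf-straight-joins _ _ _ _ (there (here refl)) = refl

∈-options-first : ∀ {o} → o ∈ options first → o ≡ 0
∈-options-first (here refl) = refl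

∈-options-turn : ∀ {o} → o ∈ options turn → o ≡ 0
∈-options-turn (here refl) = refl

module Ribbon (S : Box → Bool) (shape : IsRibbonShape S) where
  open IsRibbonShape shape

  In : Box → Set
  In b = S b ≡ true

  leftOf rightOf belowOf aboveOf : Box → Box
  leftOf  (i , j) = (i , j ∸ 1)
  rightOf (i , j) = (i , suc j)
  belowOf (i , j) = (suc i , j)
  aboveOf (i , j) = (i ∸ 1 , j)

  hasLeft hasRight hasBelow hasAbove hasPrev hasNext : Box → Bool
  hasLeft  b = S (leftOf b)
  hasRight b = S (rightOf b)
  hasBelow b = S (belowOf b)
  hasAbove b = S (aboveOf b)
  hasPrev  b = hasLeft b ∨ hasBelow b
  hasNext  b = hasRight b ∨ hasAbove b

  prev next : Box → Box
  prev b = if hasLeft b then leftOf b else belowOf b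
  next b = if hasRight b then rightOf b else aboveOf b

  In⇒row-suc : ∀ i j → In (i , j) → ∃ λ i′ → i ≡ suc i′
  In⇒row-suc zero    j s with () ← proj₁ (shifted 0 j s)
  In⇒row-suc (suc i) j _ = i , refl

  In⇒col-suc : ∀ i j → In (i , j) → ∃ λ j′ → j ≡ suc j′
  In⇒col-suc i zero    s with () ← uncurry ℕₚ.≤-trans (shifted i 0 s)
  In⇒col-suc i (suc j) _ = j , refl

  rightOf-leftOf : ∀ b → hasLeft b ≡ true → rightOf (leftOf b) ≡ b
  rightOf-leftOf (i , zero)  s with In⇒col-suc i zero s
  ... | _ , ()
  rightOf-leftOf (i , suc j) _ = refl

  belowOf-aboveOf : ∀ b → hasAbove b ≡ true → belowOf (aboveOf b) ≡ b
  belowOf-aboveOf (zero  , j) s with In⇒row-suc zero j s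
  ... | _ , ()
  belowOf-aboveOf (suc i , j) _ = refl

  hasLeft⇒¬hasBelow : ∀ b → hasLeft b ≡ true → hasBelow b ≡ false
  hasLeft⇒¬hasBelow (i , zero)  s with In⇒col-suc i zero s
  ... | _ , ()
  hasLeft⇒¬hasBelow (i , suc j) s = ≢true⇒≡false (no-diagonal i j s)

  hasBelow⇒¬hasLeft : ∀ b → hasBelow b ≡ true → hasLeft b ≡ false
  hasBelow⇒¬hasLeft b eD = ≢true⇒≡false (λ eL → true≢false (trans (sym eD) (hasLeft⇒¬hasBelow b eL)))

  ¬hasRight-belowOf : ∀ b → In b → hasRight (belowOf b) ≡ false
  ¬hasRight-belowOf (i , j) s = ≢true⇒≡false (no-diagonal i j s)

  ¬hasLeft-aboveOf : ∀ b → In b → hasLeft (aboveOf b) ≡ false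
  ¬hasLeft-aboveOf (zero  , j)     s with In⇒row-suc zero j s
  ... | _ , ()
  ¬hasLeft-aboveOf (suc i , zero)  s with In⇒col-suc (suc i) zero s
  ... | _ , ()
  ¬hasLeft-aboveOf (suc i , suc j) s = ≢true⇒≡false (λ u → no-diagonal i j u s)

  prev-cases : ∀ b → hasPrev b ≡ true →
               (hasLeft b ≡ true × prev b ≡ leftOf b) ⊎ (hasLeft b ≡ false × hasBelow b ≡ true × prev b ≡ belowOf b)
  prev-cases b p with hasLeft b
  ... | true  = inj₁ (refl , refl)
  ... | false = inj₂ (refl , p , refl)

  prev-In : ∀ b → hasPrev b ≡ true → In (prev b)
  prev-In b p with hasLeft b in eL
  ... | true  = eL
  ... | false = p

  next-In : ∀ b → hasNext b ≡ true → In (next b)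
  next-In b n with hasRight b in eR
  ... | true  = eR
  ... | false = n

  prev-next : ∀ b → In b → hasNext b ≡ true → hasPrev (next b) ≡ true × prev (next b) ≡ b
  prev-next b s n with hasRight b in eR
  ... | true  = ∨-true⁺ˡ (hasBelow (rightOf b)) s , if-true (leftOf (rightOf b)) (belowOf (rightOf b)) s
  ... | false =
    subst (λ c → hasLeft (aboveOf b) ∨ S c ≡ true) (sym (belowOf-aboveOf b n)) (∨-true⁺ʳ (hasLeft (aboveOf b)) s) ,
    trans (if-false (leftOf (aboveOf b)) (belowOf (aboveOf b)) (¬hasLeft-aboveOf b s)) (belowOf-aboveOf b n)

  next-prev : ∀ b → In b → hasPrev b ≡ true → hasNext (prev b) ≡ true × next (prev b) ≡ b
  next-prev b s p with hasLeft b in eL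
  ... | true  =
    subst (λ c → S c ∨ hasAbove (leftOf b) ≡ true) (sym (rightOf-leftOf b eL)) (∨-true⁺ˡ (hasAbove (leftOf b)) s) ,
    trans (if-true (rightOf (leftOf b)) (aboveOf (leftOf b)) (subst In (sym (rightOf-leftOf b eL)) s)) (rightOf-leftOf b eL)
  ... | false = ∨-true⁺ʳ (hasRight (belowOf b)) s , if-false (rightOf (belowOf b)) (aboveOf (belowOf b)) (¬hasRight-belowOf b s)

  offset : Box → ℕ
  offset (i , j) = j ∸ i

  offset-prev : ∀ b → hasPrev b ≡ true → offset b ≡ suc (offset (prev b))
  offset-prev b p with prev-cases b p
  offset-prev (i , zero)  p | inj₁ (eL , _) with In⇒col-suc i zero eL
  ... | _ , ()
  offset-prev (i , suc j) p | inj₁ (eL , ep) =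
    trans (ℕₚ.+-∸-assoc 1 (proj₂ (shifted i j eL))) (cong (suc ∘ offset) (sym ep))
  offset-prev (i , zero)  p | inj₂ (_ , eD , _) with In⇒col-suc (suc i) zero eD
  ... | _ , ()
  offset-prev (i , suc j) p | inj₂ (_ , eD , ep) =
    trans (ℕₚ.+-∸-assoc 1 (ℕₚ.≤-pred (proj₂ (shifted (suc i) (suc j) eD)))) (cong (suc ∘ offset) (sym ep))

  walkBack : (Box → Bool) → ℕ → Box → Box
  walkBack p zero    b = b
  walkBack p (suc n) b = if p b then walkBack p n (prev b) else b

  -- The walk from b goes back along prev while p holds; offset b + 1 steps always suffice
  -- because offset drops by one at each step.
  origin : (Box → Bool) → Box → Box
  origin p b = walkBack p (suc (offset b)) b

  module Origin (p : Box → Bool) (p⇒hasPrev : ∀ b → p b ≡ true → hasPrev b ≡ true) where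

    origin-step : ∀ b → (p b ≡ false × origin p b ≡ b) ⊎ (p b ≡ true × origin p b ≡ origin p (prev b))
    origin-step b with p b in pb
    ... | false = inj₁ (refl , refl)
    ... | true  = inj₂ (refl , cong (λ n → walkBack p n (prev b)) (offset-prev b (p⇒hasPrev b pb)))

    origin-ind : (P : Box → Set) →
                 (∀ b → In b → p b ≡ false → origin p b ≡ b → P b) →
                 (∀ b → In b → p b ≡ true → origin p b ≡ origin p (prev b) → P (prev b) → P b) →
                 ∀ b → In b → P b
    origin-ind P stop continue b = go (offset b) b refl
      where
      go : ∀ n b → offset b ≡ n → In b → P b
      go n b ob≡n s with origin-step b
      ... | inj₁ (pb , e) = stop b s pb e
      ... | inj₂ (pb , e) with offset-prev b (p⇒hasPrev b pb) | n
      ...   | ob≡ | zero   = ⊥-elim (ℕₚ.0≢1+n (trans (sym ob≡n) ob≡))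
      ...   | ob≡ | suc n′ = continue b s pb e (go n′ (prev b) (ℕₚ.suc-injective (trans (sym ob≡) ob≡n))
                                                   (prev-In b (p⇒hasPrev b pb)))

    origin-In : ∀ b → In b → In (origin p b)
    origin-In = origin-ind (In ∘ origin p) (λ b s _ e → subst In (sym e) s) (λ b _ _ e ih → subst In (sym e) ih)

    origin-stops : ∀ b → In b → p (origin p b) ≡ false
    origin-stops = origin-ind (λ b → p (origin p b) ≡ false)
      (λ b _ pb e → subst (λ c → p c ≡ false) (sym e) pb) (λ b _ _ e ih → subst (λ c → p c ≡ false) (sym e) ih)

    offset-origin≤ : ∀ b → In b → offset (origin p b) ≤ offset b
    offset-origin≤ = origin-ind (λ b → offset (origin p b) ≤ offset b)
      (λ b _ _ e → ℕₚ.≤-reflexive (cong offset e))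
      (λ b _ pb e ih → subst (λ c → offset c ≤ offset b) (sym e)
         (ℕₚ.≤-trans ih (subst (offset (prev b) ≤_) (sym (offset-prev b (p⇒hasPrev b pb))) (ℕₚ.n≤1+n _))))

    origin-prev≢ : ∀ b → In b → hasPrev b ≡ true → origin p (prev b) ≢ b
    origin-prev≢ b s hp e = ℕₚ.<-irrefl refl
      (subst (λ c → offset c < offset b) e
        (subst (offset (origin p (prev b)) <_) (sym (offset-prev b hp)) (s≤s (offset-origin≤ (prev b) (prev-In b hp)))))

    origin-idem : ∀ b → In b → origin p (origin p b) ≡ origin p b
    origin-idem b s with origin-step (origin p b)
    ... | inj₁ (_ , e)  = e
    ... | inj₂ (pb , _) = ⊥-elim (true≢false (trans (sym pb) (origin-stops b s)))

  boxType : Box → BoxType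
  boxType b = classify (hasPrev b) (hasPrev (prev b)) (hasLeft b) (hasLeft (prev b)) (hasNext b)

  forcedEntry : Box → ℕ
  forcedEntry b = if hasLeft b then 2 else 1

  matchingEntry-prev : ∀ b → In b → hasPrev b ≡ true → matchingEntry (hasRight (prev b)) ≡ forcedEntry b
  matchingEntry-prev b s hp with prev-cases b hp
  ... | inj₁ (eL , ep) rewrite ep | eL = cong matchingEntry (subst In (sym (rightOf-leftOf b eL)) s)
  ... | inj₂ (eL , eD , ep) rewrite ep | eL = cong matchingEntry (¬hasRight-belowOf b s)

  boxType-isolated : ∀ b → hasPrev b ≡ false → hasNext b ≡ false → boxType b ≡ isolated
  boxType-isolated b np nn = cong₂ (λ p n → classify p (hasPrev (prev b)) (hasLeft b) (hasLeft (prev b)) n) np nn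

  boxType-first : ∀ b → hasPrev b ≡ false → hasNext b ≡ true → boxType b ≡ first
  boxType-first b np hn = cong₂ (λ p n → classify p (hasPrev (prev b)) (hasLeft b) (hasLeft (prev b)) n) np hn

  boxType-second : ∀ b → hasPrev b ≡ true → hasPrev (prev b) ≡ false → boxType b ≡ second
  boxType-second b hp npp = cong₂ (λ p pp → classify p pp (hasLeft b) (hasLeft (prev b)) (hasNext b)) hp npp

  isolated?-boxType : ∀ b → does (isolated ≟ᵗ boxType b) ≡ not (hasPrev b ∨ hasNext b)
  isolated?-boxType b = isolated?-classify (hasPrev b) (hasPrev (prev b)) (hasLeft b) (hasLeft (prev b)) (hasNext b)

  turn?-boxType : ∀ b → does (turn ≟ᵗ boxType b) ≡ (hasBelow b ∧ hasLeft (belowOf b)) ∨ (hasLeft b ∧ hasBelow (leftOf b))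
  turn?-boxType b with true-or-false (hasLeft b)
  ... | inj₁ eL = begin
    does (turn ≟ᵗ boxType b)
      ≡⟨ cong₂ (λ l p → does (turn ≟ᵗ classify (l ∨ hasBelow b) (hasPrev p) l (hasLeft p) (hasNext b))) eL (if-true _ _ eL) ⟩
    does (turn ≟ᵗ classify true (hasPrev (leftOf b)) true (hasLeft (leftOf b)) (hasNext b))
      ≡⟨ turn?-classify-fromLeft (hasLeft (leftOf b)) (hasBelow (leftOf b)) (hasNext b) (hasBelow⇒¬hasLeft (leftOf b)) ⟩
    hasBelow (leftOf b)
      ≡⟨ sym (cong₂ (λ d l → (d ∧ hasLeft (belowOf b)) ∨ (l ∧ hasBelow (leftOf b))) (hasLeft⇒¬hasBelow b eL) eL) ⟩
    (hasBelow b ∧ hasLeft (belowOf b)) ∨ (hasLeft b ∧ hasBelow (leftOf b)) ∎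
    where open ≡-Reasoning
  ... | inj₂ eL with true-or-false (hasBelow b)
  ...   | inj₁ eD = begin
    does (turn ≟ᵗ boxType b)
      ≡⟨ cong₂ (λ l p → does (turn ≟ᵗ classify (l ∨ hasBelow b) (hasPrev p) l (hasLeft p) (hasNext b))) eL (if-false _ _ eL) ⟩
    does (turn ≟ᵗ classify (hasBelow b) (hasPrev (belowOf b)) false (hasLeft (belowOf b)) (hasNext b))
      ≡⟨ cong (λ d → does (turn ≟ᵗ classify d (hasPrev (belowOf b)) false (hasLeft (belowOf b)) (hasNext b))) eD ⟩
    does (turn ≟ᵗ classify true (hasPrev (belowOf b)) false (hasLeft (belowOf b)) (hasNext b))
      ≡⟨ turn?-classify-fromBelow (hasLeft (belowOf b)) (hasBelow (belowOf b)) (hasNext b) ⟩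
    hasLeft (belowOf b)
      ≡⟨ sym (trans (cong₂ (λ d l → (d ∧ hasLeft (belowOf b)) ∨ (l ∧ hasBelow (leftOf b))) eD eL) (Boolₚ.∨-identityʳ _)) ⟩
    (hasBelow b ∧ hasLeft (belowOf b)) ∨ (hasLeft b ∧ hasBelow (leftOf b)) ∎
    where open ≡-Reasoning
  ...   | inj₂ eD = begin
    does (turn ≟ᵗ boxType b)
      ≡⟨ cong (λ p → does (turn ≟ᵗ classify p (hasPrev (prev b)) (hasLeft b) (hasLeft (prev b)) (hasNext b))) (cong₂ _∨_ eL eD) ⟩
    does (turn ≟ᵗ classify false (hasPrev (prev b)) (hasLeft b) (hasLeft (prev b)) (hasNext b))
      ≡⟨ turn?-classify-noPrev (hasPrev (prev b)) (hasLeft b) (hasLeft (prev b)) (hasNext b) ⟩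
    false
      ≡⟨ sym (cong₂ (λ d l → (d ∧ hasLeft (belowOf b)) ∨ (l ∧ hasBelow (leftOf b))) eD eL) ⟩
    (hasBelow b ∧ hasLeft (belowOf b)) ∨ (hasLeft b ∧ hasBelow (leftOf b)) ∎
    where open ≡-Reasoning

module _ {A : Set} (c : A → BoxType) where

  countType : BoxType → List A → ℕ
  countType k xs = length (filterB (λ x → does (k ≟ᵗ c x)) xs)

  length-byType : ∀ xs → length xs ≡ countType isolated xs ℕ.+ countType first xs ℕ.+ countType second xs
                                     ℕ.+ countType straight xs ℕ.+ countType turn xs
  length-byType []       = refl
  length-byType (x ∷ xs) with c x | length-byType xs
  ... | isolated | ih = cong suc ih
  ... | first    | ih = trans (cong suc ih)
                          (sym (cong (λ z → z ℕ.+ n second ℕ.+ n straight ℕ.+ n turn) (ℕₚ.+-suc (n isolated) (n first))))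
    where
    n : BoxType → ℕ
    n k = countType k xs
  ... | second   | ih = trans (cong suc ih)
                          (sym (cong (λ z → z ℕ.+ n straight ℕ.+ n turn) (ℕₚ.+-suc (n isolated ℕ.+ n first) (n second))))
    where
    n : BoxType → ℕ
    n k = countType k xs
  ... | straight | ih = trans (cong suc ih)
                          (sym (cong (ℕ._+ n turn) (ℕₚ.+-suc (n isolated ℕ.+ n first ℕ.+ n second) (n straight))))
    where
    n : BoxType → ℕ
    n k = countType k xs
  ... | turn     | ih = trans (cong suc ih)
                          (sym (ℕₚ.+-suc (n isolated ℕ.+ n first ℕ.+ n second ℕ.+ n straight) (n turn)))
    where
    n : BoxType → ℕ
    n k = countType k xs

  powerOf : (BoxType → ℤ) → List A → BoxType → ℤ
  powerOf g xs k = g k ^ countType k xs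

  prodBy-byType : ∀ (g : BoxType → ℤ) xs →
    prodBy (g ∘ c) xs ≡ powerOf g xs isolated * powerOf g xs first * powerOf g xs second * powerOf g xs straight * powerOf g xs turn
  prodBy-byType g []       = refl
  prodBy-byType g (x ∷ xs) with c x | prodBy-byType g xs
  ... | isolated | ih = trans (cong (g isolated *_) ih) (shuffle (g isolated) (P isolated) (P first) (P second) (P straight) (P turn))
    where
    P : BoxType → ℤ
    P = powerOf g xs
    shuffle : ∀ a A B C D E → a * (A * B * C * D * E) ≡ a * A * B * C * D * E
    shuffle = solve-∀
  ... | first    | ih = trans (cong (g first *_) ih) (shuffle (g first) (P isolated) (P first) (P second) (P straight) (P turn))
    where
    P : BoxType → ℤ
    P = powerOf g xs
    shuffle : ∀ a A B C D E → a * (A * B * C * D * E) ≡ A * (a * B) * C * D * E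
    shuffle = solve-∀
  ... | second   | ih = trans (cong (g second *_) ih) (shuffle (g second) (P isolated) (P first) (P second) (P straight) (P turn))
    where
    P : BoxType → ℤ
    P = powerOf g xs
    shuffle : ∀ a A B C D E → a * (A * B * C * D * E) ≡ A * B * (a * C) * D * E
    shuffle = solve-∀
  ... | straight | ih = trans (cong (g straight *_) ih) (shuffle (g straight) (P isolated) (P first) (P second) (P straight) (P turn))
    where
    P : BoxType → ℤ
    P = powerOf g xs
    shuffle : ∀ a A B C D E → a * (A * B * C * D * E) ≡ A * B * C * (a * D) * E
    shuffle = solve-∀
  ... | turn     | ih = trans (cong (g turn *_) ih) (shuffle (g turn) (P isolated) (P first) (P second) (P straight) (P turn))
    where
    P : BoxType → ℤ
    P = powerOf g xs
    shuffle : ∀ a A B C D E → a * (A * B * C * D * E) ≡ A * B * C * D * (a * E)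
    shuffle = solve-∀

typeWeight : ℤ → ℤ → BoxType → ℤ
typeWeight t β isolated = + 2 * t
typeWeight t β first    = t
typeWeight t β second   = + 2 * t - β
typeWeight t β straight = t - β
typeWeight t β turn     = t

optionWeight : ℤ → ℤ → BoxType → ℕ → ℤ
optionWeight t β k o = if joins k o then - β else t

sumBy-optionWeight : ∀ t β k → sumBy (optionWeight t β k) (options k) ≡ typeWeight t β k
sumBy-optionWeight t β isolated = isolated-sum t
  where
  isolated-sum : ∀ t → t + (t + 0ℤ) ≡ + 2 * t
  isolated-sum = solve-∀
sumBy-optionWeight t β first    = ℤₚ.+-identityʳ t
sumBy-optionWeight t β second   = second-sum t β
  where
  second-sum : ∀ t β → t + (t + (- β + 0ℤ)) ≡ + 2 * t - β
  second-sum = solve-∀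
sumBy-optionWeight t β straight = cong (_+_ t) (ℤₚ.+-identityʳ (- β))
sumBy-optionWeight t β turn     = ℤₚ.+-identityʳ t

*-^-distrib : ∀ (a b : ℤ) n → (a * b) ^ n ≡ a ^ n * b ^ n
*-^-distrib a b zero    = refl
*-^-distrib a b (suc n) = trans (cong ((a * b) *_) (*-^-distrib a b n)) (interchange a b (a ^ n) (b ^ n))
  where
  interchange : ∀ a b x y → a * b * (x * y) ≡ a * x * (b * y)
  interchange = solve-∀

res-arith : ∀ a b c d e → b ≡ c → + (a ℕ.+ b ℕ.+ c ℕ.+ d ℕ.+ e) - + a - + (2 ℕ.* b) - + e + + 2 - + 2 ≡ + d
res-arith a b .b d e refl = cancel (+ a) (+ b) (+ d) (+ e)
  where
  cancel : ∀ A B D E → A + B + B + D + E - A - (B + (B + + 0)) - E + + 2 - + 2 ≡ D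
  cancel = solve-∀

-- s, m, st and u stand for the numbers of isolated, first (= second), straight and turn boxes.
generating-identity : ∀ (t β : ℤ) s m st u →
    (+ 2 * t) ^ s * t ^ m * (+ 2 * t - β) ^ m * (t - β) ^ st * t ^ u
      * (t - β) ^ neg (+ st) * t ^ neg (+ s + + m + + u - + 1) * (+ 2 * t - β) ^ neg (+ m - + 1)
    ≡ (+ 2 * t * t - β * t) * (t - β) ^ pos (+ st) * (+ 2) ^ s
      * t ^ pos (+ s + + m + + u - + 1) * (+ 2 * t - β) ^ pos (+ m - + 1)
generating-identity t β s (suc m) st u
  rewrite ℕₚ.+-suc s m | *-^-distrib (+ 2) t s | ℤₚ.^-distribˡ-+-* t (s ℕ.+ m) u | ℤₚ.^-distribˡ-+-* t s m =
  normalise t β ((+ 2) ^ s) (t ^ s) (t ^ m) ((+ 2 * t - β) ^ m) ((t - β) ^ st) (t ^ u)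
  where
  normalise : ∀ t β P Tˢ Tᵐ Q R Tᵘ → P * Tˢ * (t * Tᵐ) * ((+ 2 * t - β) * Q) * R * Tᵘ * 1ℤ * 1ℤ * 1ℤ
                                    ≡ (+ 2 * t * t - β * t) * R * P * (Tˢ * Tᵐ * Tᵘ) * Q
  normalise = solve-∀
generating-identity t β (suc s) zero st u
  rewrite ℕₚ.+-identityʳ s | *-^-distrib (+ 2) t s | ℤₚ.^-distribˡ-+-* t s u =
  normalise t β ((+ 2) ^ s) (t ^ s) ((t - β) ^ st) (t ^ u)
  where
  normalise : ∀ t β P Tˢ R Tᵘ → + 2 * t * (P * Tˢ) * 1ℤ * 1ℤ * R * Tᵘ * 1ℤ * 1ℤ * ((+ 2 * t - β) * 1ℤ)
                              ≡ (+ 2 * t * t - β * t) * R * (+ 2 * P) * (Tˢ * Tᵘ) * 1ℤ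
  normalise = solve-∀
generating-identity t β zero zero st (suc u) = normalise t β ((t - β) ^ st) (t ^ u)
  where
  normalise : ∀ t β R Tᵘ → 1ℤ * 1ℤ * 1ℤ * R * (t * Tᵘ) * 1ℤ * 1ℤ * ((+ 2 * t - β) * 1ℤ)
                         ≡ (+ 2 * t * t - β * t) * R * 1ℤ * Tᵘ * 1ℤ
  normalise = solve-∀
generating-identity t β zero zero st zero = normalise t β ((t - β) ^ st)
  where
  normalise : ∀ t β R → 1ℤ * 1ℤ * 1ℤ * R * 1ℤ * 1ℤ * (t * 1ℤ) * ((+ 2 * t - β) * 1ℤ)
                       ≡ (+ 2 * t * t - β * t) * R * 1ℤ * 1ℤ * 1ℤ
  normalise = solve-∀

spec-varIndex≡0 : ∀ t v → v ≢ 1 → v ≢ 2 → spec t (varIndex v) ≡ 0ℤ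
spec-varIndex≡0 t 0                   _   _   = refl
spec-varIndex≡0 t 1                   v≢1 _   = ⊥-elim (v≢1 refl)
spec-varIndex≡0 t 2                   _   v≢2 = ⊥-elim (v≢2 refl)
spec-varIndex≡0 t (suc (suc (suc w))) _   _   = cong (spec t) varIndex≡2+
  where
  varIndex≡2+ : varIndex (3 ℕ.+ w) ≡ 2 ℕ.+ (w ℕ./ 2)
  varIndex≡2+ = trans (m/n≡1+[m∸n]/n {4 ℕ.+ w} {2} (s≤s (s≤s z≤n)))
                      (cong suc (m/n≡1+[m∸n]/n {2 ℕ.+ w} {2} (s≤s (s≤s z≤n))))

1≢2 : 1 ≢ 2
1≢2 ()

2≰1 : ¬ 2 ≤ 1
2≰1 (s≤s ())

¬Unprimed1 : ¬ Unprimed 1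
¬Unprimed1 ()

¬Primed2 : ¬ Primed 2
¬Primed2 ()

-- S is an opaque copy of skew Λ Ψ: keeping membership abstract stops it from unfolding
-- into inSD arithmetic during with-abstraction.
module RibbonTableaux (Λ Ψ : List ℕ) (S : Box → Bool) (S≡skew : ∀ b → S b ≡ skew Λ Ψ b) (shape : IsRibbonShape S)
                      (Ψ⊆Λ : Ψ ⊆SD Λ) where
  open IsRibbonShape shape
  open Ribbon S shape public

  toIn : ∀ {b} → Sk Λ Ψ b → In b
  toIn {b} s = trans (S≡skew b) s

  fromIn : ∀ {b} → In b → Sk Λ Ψ b
  fromIn {b} s = trans (sym (S≡skew b)) s

  fill : (Box → ℕ) → Box → ℕ
  fill f b = entryOf (hasLeft b) (hasBelow b) (hasNext b) (f (next b)) (f b) (hasRight b)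

  joinsPrev : (Box → ℕ) → Box → Bool
  joinsPrev f b = joins (boxType b) (f b)

  joinsPrev⇒hasPrev : ∀ f b → joinsPrev f b ≡ true → hasPrev b ≡ true
  joinsPrev⇒hasPrev f b j with boxType b in et
  ... | second   = proj₁ (classify-second et)
  ... | straight = proj₁ (classify-straight et)

  barHead : (Box → ℕ) → Box → Box
  barHead f = origin (joinsPrev f)

  tableauOf : (Box → ℕ) → Tableau
  tableauOf f = tab (fill f) (barHead f)

  fill-forced : ∀ f b → hasPrev b ≡ true → fill f b ≡ forcedEntry b
  fill-forced f b hp with prev-cases b hp
  ... | inj₁ (eL , _)      = trans (entryOf-fromLeft {hasLeft b} eL) (sym (if-true 2 1 eL))
  ... | inj₂ (eL , eD , _) = trans (entryOf-fromBelow {hasLeft b} eL eD) (sym (if-false 2 1 eL))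

  fill-1-or-2 : ∀ f b → fill f b ≡ 1 ⊎ fill f b ≡ 2
  fill-1-or-2 f b = entryOf-1-or-2 (hasLeft b) (hasBelow b) (hasNext b) (f (next b)) (f b) (hasRight b)

  ¬hasPrev⇒ : ∀ b → hasPrev b ≡ false → hasLeft b ≡ false × hasBelow b ≡ false
  ¬hasPrev⇒ b = ∨-false⁻ {hasLeft b}

  fill-first : ∀ f b → hasPrev b ≡ false → hasNext b ≡ true →
               fill f b ≡ ifZero (f (next b)) (otherEntry (hasRight b)) (matchingEntry (hasRight b))
  fill-first f b np hn = let eL , eD = ¬hasPrev⇒ b np in entryOf-first {hasLeft b} eL eD hn

  fill-isolated : ∀ f b → hasPrev b ≡ false → hasNext b ≡ false → fill f b ≡ ifZero (f b) 1 2
  fill-isolated f b np nn = let eL , eD = ¬hasPrev⇒ b np in entryOf-isolated {hasLeft b} eL eD nn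

  fill-joinsPrev : ∀ f b → In b → joinsPrev f b ≡ true → fill f b ≡ fill f (prev b)
  fill-joinsPrev f b s j with boxType b in et
  ... | straight =
    let hp , hpp , l≡lp = classify-straight et
    in trans (fill-forced f b hp) (trans (cong (λ l → if l then 2 else 1) l≡lp) (sym (fill-forced f (prev b) hpp)))
  ... | second =
    let hp , hpp  = classify-second et
        hn , np≡b = next-prev b s hp
        r         = hasRight (prev b)
    in sym (begin
      fill f (prev b)
        ≡⟨ fill-first f (prev b) hpp hn ⟩
      ifZero (f (next (prev b))) (otherEntry r) (matchingEntry r)
        ≡⟨ cong (λ o → ifZero o (otherEntry r) (matchingEntry r)) (trans (cong f np≡b) (joins-second (f b) j)) ⟩
      matchingEntry r
        ≡⟨ matchingEntry-prev b s hp ⟩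
      forcedEntry b
        ≡⟨ sym (fill-forced f b hp) ⟩
      fill f b ∎)
    where open ≡-Reasoning

  module OfChoice (f : Box → ℕ) where
    open Origin (joinsPrev f) (joinsPrev⇒hasPrev f) public

    fill-barHead : ∀ b → In b → fill f b ≡ fill f (barHead f b)
    fill-barHead = origin-ind (λ b → fill f b ≡ fill f (barHead f b)) (λ b _ _ e → cong (fill f) (sym e))
                     (λ b s j e ih → trans (fill-joinsPrev f b s j) (trans ih (cong (fill f) (sym e))))

    RowBar ColumnBar : Box → Set
    RowBar b = row (barHead f b) ≡ row b × col (barHead f b) ≤ col b ×
               (∀ k → col (barHead f b) ≤ k → k ≤ col b → In (row b , k) × barHead f (row b , k) ≡ barHead f b)
    ColumnBar b = col (barHead f b) ≡ col b × row b ≤ row (barHead f b) ×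
                  (∀ k → row b ≤ k → k ≤ row (barHead f b) → In (k , col b) × barHead f (k , col b) ≡ barHead f b)

    RowBar-head : ∀ b → In b → barHead f b ≡ b → RowBar b
    RowBar-head b s e =
      cong row e , ℕₚ.≤-reflexive (cong col e) ,
      λ k lo hi → let k≡ = ℕₚ.≤-antisym hi (subst (λ c → col c ≤ k) e lo)
                  in subst (λ z → In (row b , z) × barHead f (row b , z) ≡ barHead f b) (sym k≡) (s , refl)

    ColumnBar-head : ∀ b → In b → barHead f b ≡ b → ColumnBar b
    ColumnBar-head b s e =
      cong col e , ℕₚ.≤-reflexive (cong row (sym e)) ,
      λ k lo hi → let k≡ = ℕₚ.≤-antisym (subst (λ c → k ≤ row c) e hi) lo
                  in subst (λ z → In (z , col b) × barHead f (z , col b) ≡ barHead f b) (sym k≡) (s , refl)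

    unprimed⇒RowBar : ∀ b → In b → fill f b ≡ 2 → RowBar b
    unprimed⇒RowBar = origin-ind (λ b → fill f b ≡ 2 → RowBar b) (λ b s _ e _ → RowBar-head b s e) extend
      where
      extend : ∀ b → In b → joinsPrev f b ≡ true → barHead f b ≡ barHead f (prev b) →
               (fill f (prev b) ≡ 2 → RowBar (prev b)) → fill f b ≡ 2 → RowBar b
      extend (i , j) s jn e ih v2 with prev-cases (i , j) (joinsPrev⇒hasPrev f (i , j) jn)
      ... | inj₂ (eL , eD , _) = ⊥-elim (1≢2 (trans (sym (entryOf-fromBelow {hasLeft (i , j)} eL eD)) v2))
      ... | inj₁ (eL , ep) with In⇒col-suc i (j ∸ 1) eL
      extend (i , zero)  s jn e ih v2 | inj₁ (eL , ep) | _ , ()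
      extend (i , suc j) s jn e ih v2 | inj₁ (eL , ep) | _ =
        let sameRow , start≤ , covers = prevBar
        in trans (cong row e′) sameRow , subst (λ c → col c ≤ suc j) (sym e′) (ℕₚ.m≤n⇒m≤1+n start≤) ,
           λ k lo hi → grow k (subst (λ c → col c ≤ k) e′ lo) hi covers
        where
        prevBar : RowBar (i , j)
        prevBar = subst RowBar ep (ih (trans (sym (fill-joinsPrev f (i , suc j) s jn)) v2))
        e′ : barHead f (i , suc j) ≡ barHead f (i , j)
        e′ = trans e (cong (barHead f) ep)
        grow : ∀ k → col (barHead f (i , j)) ≤ k → k ≤ suc j →
               (∀ k → col (barHead f (i , j)) ≤ k → k ≤ j → In (i , k) × barHead f (i , k) ≡ barHead f (i , j)) →
               In (i , k) × barHead f (i , k) ≡ barHead f (i , suc j)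
        grow k lo hi covers with ℕₚ.m≤n⇒m<n∨m≡n hi
        ... | inj₁ (s≤s k≤j) = let k∈ , same = covers k lo k≤j in k∈ , trans same (sym e′)
        ... | inj₂ refl      = s , refl

    primed⇒ColumnBar : ∀ b → In b → fill f b ≡ 1 → ColumnBar b
    primed⇒ColumnBar = origin-ind (λ b → fill f b ≡ 1 → ColumnBar b) (λ b s _ e _ → ColumnBar-head b s e) extend
      where
      extend : ∀ b → In b → joinsPrev f b ≡ true → barHead f b ≡ barHead f (prev b) →
               (fill f (prev b) ≡ 1 → ColumnBar (prev b)) → fill f b ≡ 1 → ColumnBar b
      extend (i , j) s jn e ih v1 with prev-cases (i , j) (joinsPrev⇒hasPrev f (i , j) jn)
      ... | inj₁ (eL , _) = ⊥-elim (1≢2 (trans (sym v1) (entryOf-fromLeft {hasLeft (i , j)} eL)))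
      ... | inj₂ (eL , eD , ep) =
        let sameCol , ≤end , covers = prevBar
        in trans (cong col e′) sameCol , subst (λ c → i ≤ row c) (sym e′) (ℕₚ.<⇒≤ ≤end) ,
           λ k lo hi → grow k lo (subst (λ c → k ≤ row c) e′ hi) covers
        where
        prevBar : ColumnBar (suc i , j)
        prevBar = subst ColumnBar ep (ih (trans (sym (fill-joinsPrev f (i , j) s jn)) v1))
        e′ : barHead f (i , j) ≡ barHead f (suc i , j)
        e′ = trans e (cong (barHead f) ep)
        grow : ∀ k → i ≤ k → k ≤ row (barHead f (suc i , j)) →
               (∀ k → suc i ≤ k → k ≤ row (barHead f (suc i , j)) → In (k , j) × barHead f (k , j) ≡ barHead f (suc i , j)) →
               In (k , j) × barHead f (k , j) ≡ barHead f (i , j)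
        grow k lo hi covers with ℕₚ.m≤n⇒m<n∨m≡n lo
        ... | inj₁ i<k  = let k∈ , same = covers k i<k hi in k∈ , trans same (sym e′)
        ... | inj₂ refl = s , refl

    upper-primed : ∀ b c → In b → In c → col b ≡ col c → row b < row c → fill f b ≢ 2
    upper-primed b c sb sc ce lt v2 =
      let below = column-step (row b) (row c) (col b) sb (subst (λ z → In (row c , z)) (sym ce) sc) lt
      in 1≢2 (trans (sym (entryOf-fromBelow {hasLeft b} (hasBelow⇒¬hasLeft b below) below)) v2)

    right-unprimed : ∀ b c → In b → In c → row b ≡ row c → col b < col c → fill f c ≢ 1
    right-unprimed b (i , suc j) sb sc re (s≤s lt) v1 =
      let left = row-convex i (col b) (suc j) j (subst (λ z → In (z , col b)) re sb) sc lt (ℕₚ.n≤1+n j)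
      in 1≢2 (trans (sym v1) (entryOf-fromLeft {hasLeft (i , suc j)} left))

    fill-sameBar : ∀ b c → In b → In c → barHead f b ≡ barHead f c → fill f b ≡ fill f c
    fill-sameBar b c sb sc e = trans (fill-barHead b sb) (trans (cong (fill f) e) (sym (fill-barHead c sc)))

    column-primed : ∀ b c → In b → In c → b ≢ c → col b ≡ col c → fill f b ≡ fill f c → Primed (fill f b)
    column-primed b c sb sc b≢c ce ve with fill-1-or-2 f b
    ... | inj₁ e = subst Primed (sym e) refl
    ... | inj₂ e with ℕₚ.<-cmp (row b) (row c)
    ...   | tri< lt _ _ = ⊥-elim (upper-primed b c sb sc ce lt e)
    ...   | tri≈ _ re _ = ⊥-elim (b≢c (cong₂ _,_ re ce))
    ...   | tri> _ _ gt = ⊥-elim (upper-primed c b sc sb (sym ce) gt (trans (sym ve) e))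

    row-unprimed : ∀ b c → In b → In c → b ≢ c → row b ≡ row c → fill f b ≡ fill f c → Unprimed (fill f b)
    row-unprimed b c sb sc b≢c re ve with fill-1-or-2 f b
    ... | inj₂ e = subst Unprimed (sym e) refl
    ... | inj₁ e with ℕₚ.<-cmp (col b) (col c)
    ...   | tri< lt _ _ = ⊥-elim (right-unprimed b c sb sc re lt (trans (sym ve) e))
    ...   | tri≈ _ ce _ = ⊥-elim (b≢c (cong₂ _,_ re ce))
    ...   | tri> _ _ gt = ⊥-elim (right-unprimed c b sc sb (sym re) gt e)

    sameBar-line : ∀ b c → In b → In c → barHead f b ≡ barHead f c → row b ≡ row c ⊎ col b ≡ col c
    sameBar-line b c sb sc e with fill-1-or-2 f b
    ... | inj₁ v1 = inj₂ (trans (sym (proj₁ (primed⇒ColumnBar b sb v1)))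
                           (trans (cong col e) (proj₁ (primed⇒ColumnBar c sc (trans (sym (fill-sameBar b c sb sc e)) v1)))))
    ... | inj₂ v2 = inj₁ (trans (sym (proj₁ (unprimed⇒RowBar b sb v2)))
                           (trans (cong row e) (proj₁ (unprimed⇒RowBar c sc (trans (sym (fill-sameBar b c sb sc e)) v2)))))

    sameBar-between : ∀ b c d → In b → In c → barHead f b ≡ barHead f c → Between b c d → In d × barHead f d ≡ barHead f b
    sameBar-between b c d sb sc e (inj₁ (rbc , rdb , lbd , ldc)) with fill-1-or-2 f c
    ... | inj₂ v2 =
      let _ , _ , covers = unprimed⇒RowBar c sc v2
          _ , start≤b , _ = unprimed⇒RowBar b sb (trans (fill-sameBar b c sb sc e) v2)
          rdc = trans rdb rbc
          d∈ , same = covers (col d) (subst (λ x → col x ≤ col d) e (ℕₚ.≤-trans start≤b lbd)) ldc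
      in subst (λ z → In (z , col d)) (sym rdc) d∈ ,
         trans (cong (λ z → barHead f (z , col d)) rdc) (trans same (sym e))
    ... | inj₁ v1 with ℕₚ.m≤n⇒m<n∨m≡n (ℕₚ.≤-trans lbd ldc)
    ...   | inj₁ lt = ⊥-elim (right-unprimed b c sb sc rbc lt v1)
    ...   | inj₂ ce =
      let d≡b = cong₂ _,_ rdb (sym (ℕₚ.≤-antisym lbd (subst (col d ≤_) (sym ce) ldc)))
      in subst In (sym d≡b) sb , cong (barHead f) d≡b
    sameBar-between b c d sb sc e (inj₂ (cbc , cdb , rbd , rdc)) with fill-1-or-2 f b
    ... | inj₁ v1 =
      let _ , _ , covers = primed⇒ColumnBar b sb v1
          _ , c≤end , _ = primed⇒ColumnBar c sc (trans (sym (fill-sameBar b c sb sc e)) v1)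
          d∈ , same = covers (row d) rbd (subst (λ x → row d ≤ row x) (sym e) (ℕₚ.≤-trans rdc c≤end))
      in subst (λ z → In (row d , z)) (sym cdb) d∈ , trans (cong (λ z → barHead f (row d , z)) cdb) same
    ... | inj₂ v2 with ℕₚ.m≤n⇒m<n∨m≡n (ℕₚ.≤-trans rbd rdc)
    ...   | inj₁ lt = ⊥-elim (upper-primed b c sb sc cbc lt v2)
    ...   | inj₂ re =
      let d≡b = cong₂ _,_ (sym (ℕₚ.≤-antisym rbd (subst (row d ≤_) (sym re) rdc))) cdb
      in subst In (sym d≡b) sb , cong (barHead f) d≡b

    fill-positive : ∀ b → 1 ≤ fill f b
    fill-positive b = [ (λ e → ℕₚ.≤-reflexive (sym e)) , (λ e → subst (1 ≤_) (sym e) (s≤s z≤n)) ]′ (fill-1-or-2 f b)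

    fill≤2 : ∀ b → fill f b ≤ 2
    fill≤2 b = [ (λ e → subst (_≤ 2) (sym e) (s≤s z≤n)) , ℕₚ.≤-reflexive ]′ (fill-1-or-2 f b)

    isBarTableau : IsBarTableau Λ Ψ (tableauOf f)
    isBarTableau = record
      { entryPos  = λ b _ → fill-positive b
      ; colUnpr   = λ b c sb sc → column-primed b c (toIn sb) (toIn sc)
      ; rowPrim   = λ b c sb sc → row-unprimed b c (toIn sb) (toIn sc)
      ; repSk     = λ b s → fromIn (origin-In b (toIn s))
      ; repIdem   = λ b s → origin-idem b (toIn s)
      ; barEntry  = λ b c sb sc → fill-sameBar b c (toIn sb) (toIn sc)
      ; barLine   = λ b c sb sc → sameBar-line b c (toIn sb) (toIn sc)
      ; barContig = λ b c d sb sc e bt → let d∈ , same = sameBar-between b c d (toIn sb) (toIn sc) e bt in fromIn d∈ , same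
      }

    isSemistandard : IsSemistandard Λ Ψ (tableauOf f)
    isSemistandard = record
      { bar    = isBarTableau
      ; rowInc = λ i j s _ → subst (fill f (i , j) ≤_) (sym (entryOf-fromLeft {hasLeft (i , suc j)} (toIn s))) (fill≤2 (i , j))
      ; colInc = λ i j _ s → subst (_≤ fill f (suc i , j))
                   (sym (entryOf-fromBelow {hasLeft (i , j)} (hasBelow⇒¬hasLeft (i , j) (toIn s)) (toIn s))) (fill-positive (suc i , j))
      }

    barHead-joinsPrev : ∀ b → joinsPrev f b ≡ true → barHead f b ≡ barHead f (prev b)
    barHead-joinsPrev b j with origin-step b
    ... | inj₁ (¬j , _) = ⊥-elim (true≢false (trans (sym j) ¬j))
    ... | inj₂ (_ , e)  = e

    eqBox-barHead-prev : ∀ b → In b → hasPrev b ≡ true → eqBox (barHead f b) (barHead f (prev b)) ≡ joinsPrev f b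
    eqBox-barHead-prev b s hp with origin-step b
    ... | inj₁ (¬j , e) = trans (≢⇒eqBox _ _ (λ e′ → origin-prev≢ b s hp (trans (sym e′) e))) (sym ¬j)
    ... | inj₂ (j , e)  = trans (≡⇒eqBox _ _ e) (sym j)

    eqBox-barHead-self : ∀ b → In b → eqBox (barHead f b) b ≡ not (joinsPrev f b)
    eqBox-barHead-self b s with origin-step b
    ... | inj₁ (¬j , e) = trans (≡⇒eqBox _ _ e) (cong not (sym ¬j))
    ... | inj₂ (j , e)  = trans (≢⇒eqBox _ _ (λ e′ → origin-prev≢ b s (joinsPrev⇒hasPrev f b j) (trans (sym e) e′)))
                                (cong not (sym j))

  choiceOf : Tableau → Box → ℕ
  choiceOf T b = optionOf (boxType b) (V T b) (V T (prev b)) (matchingEntry (hasRight (prev b))) (eqBox (rep T b) (rep T (prev b)))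

  choiceOf-∈ : ∀ T b → choiceOf T b ∈ options (boxType b)
  choiceOf-∈ T b = optionOf-∈ (boxType b) _ _ _ _

  choiceOf-tableauOf : ∀ f b → In b → f b ∈ options (boxType b) → choiceOf (tableauOf f) b ≡ f b
  choiceOf-tableauOf f b s o∈ = go (boxType b) refl o∈
    where
    open OfChoice f
    vp mv : ℕ
    vp = fill f (prev b)
    mv = matchingEntry (hasRight (prev b))
    joined : Bool
    joined = eqBox (barHead f b) (barHead f (prev b))
    go : ∀ k → boxType b ≡ k → f b ∈ options k → optionOf k (fill f b) vp mv joined ≡ f b
    go isolated et o∈ =
      let np , nn = classify-isolated et
      in trans (cong (λ v → optionOf isolated v vp mv joined) (fill-isolated f b np nn))
               (optionOf-isolated-ifZero (f b) vp mv joined o∈)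
    go first    _  o∈ = sym (∈-options-first o∈)
    go turn     _  o∈ = sym (∈-options-turn o∈)
    go straight et o∈ =
      trans (cong (optionOf straight (fill f b) vp mv)
                  (trans (eqBox-barHead-prev b s (proj₁ (classify-straight et))) (cong (λ k → joins k (f b)) et)))
            (optionOf-straight-joins (f b) (fill f b) vp mv o∈)
    go second et o∈ =
      let hp , hpp = classify-second et
          hn , np≡b = next-prev b s hp
          r = hasRight (prev b)
      in trans (cong₂ (λ vp e → optionOf second (fill f b) vp mv e)
                  (trans (fill-first f (prev b) hpp hn) (cong (λ o → ifZero o (otherEntry r) (matchingEntry r)) (cong f np≡b)))
                  (trans (eqBox-barHead-prev b s hp) (cong (λ k → joins k (f b)) et)))
               (optionOf-second-ifZero (f b) (fill f b) r o∈)

  optionOf-cong-≈ : ∀ T T′ → T ≈[ Λ , Ψ ] T′ → ∀ k b → In b → hasPrev b ≡ true →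
    optionOf k (V T b) (V T (prev b)) (matchingEntry (hasRight (prev b))) (eqBox (rep T b) (rep T (prev b))) ≡
    optionOf k (V T′ b) (V T′ (prev b)) (matchingEntry (hasRight (prev b))) (eqBox (rep T′ b) (rep T′ (prev b)))
  optionOf-cong-≈ T T′ (V≗ , rep≈) k b s hp =
    let p  = prev b
        sp = fromIn (prev-In b hp)
        sb = fromIn s
    in cong₂ (λ v (vp , e) → optionOf k v vp (matchingEntry (hasRight p)) e) (V≗ b sb)
         (cong₂ _,_ (V≗ p sp) (eqBox-cong _ _ _ _ (proj₁ (rep≈ b p sb sp)) (proj₂ (rep≈ b p sb sp))))

  choiceOf-cong : ∀ T T′ → T ≈[ Λ , Ψ ] T′ → ∀ b → In b → choiceOf T b ≡ choiceOf T′ b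
  choiceOf-cong T T′ T≈T′ b s with boxType b in et
  ... | first    = refl
  ... | second   = optionOf-cong-≈ T T′ T≈T′ second b s (proj₁ (classify-second et))
  ... | straight = optionOf-cong-≈ T T′ T≈T′ straight b s (proj₁ (classify-straight et))
  ... | turn     = optionOf-cong-≈ T T′ T≈T′ turn b s (proj₁ (classify-turn et))
  ... | isolated = optionOf-isolated-cong (V T p) mv (eqBox (rep T b) (rep T p)) (V T′ p) mv (eqBox (rep T′ b) (rep T′ p))
                     (proj₁ T≈T′ b (fromIn s))
    where
    p : Box
    p = prev b
    mv : ℕ
    mv = matchingEntry (hasRight p)

  tableauOf-≉ : ∀ f g b → In b → f b ∈ options (boxType b) → g b ∈ options (boxType b) → f b ≢ g b →
                ¬ (tableauOf f ≈[ Λ , Ψ ] tableauOf g)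
  tableauOf-≉ f g b s f∈ g∈ fb≢gb f≈g =
    fb≢gb (trans (sym (choiceOf-tableauOf f b s f∈)) (trans (choiceOf-cong _ _ f≈g b s) (choiceOf-tableauOf g b s g∈)))

  -- A semistandard tableau with entries in {1′, 1} is the tableau of its own choices.
  module Agreement (T : Tableau) (ss : IsSemistandard Λ Ψ T) (entry-1-or-2 : ∀ b → In b → V T b ≡ 1 ⊎ V T b ≡ 2)
                   (f : Box → ℕ) (f≗ : ∀ b → In b → f b ≡ choiceOf T b) where
    open IsSemistandard ss
    open IsBarTableau bar
    open OfChoice f

    entry-fromLeft : ∀ b → In b → hasLeft b ≡ true → V T b ≡ 2
    entry-fromLeft (i , zero)  s eL with In⇒col-suc i zero eL
    ... | _ , ()
    entry-fromLeft (i , suc j) s eL with entry-1-or-2 (i , suc j) s | entry-1-or-2 (i , j) eL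
    ... | inj₂ e  | _       = e
    ... | inj₁ e₁ | inj₂ e₂ = ⊥-elim (2≰1 (subst₂ _≤_ e₂ e₁ (rowInc i j (fromIn eL) (fromIn s))))
    ... | inj₁ e₁ | inj₁ e₁′ = ⊥-elim (¬Unprimed1 (subst Unprimed e₁′
          (rowPrim (i , j) (i , suc j) (fromIn eL) (fromIn s) (λ e → ℕₚ.1+n≢n (sym (cong col e))) refl (trans e₁′ (sym e₁)))))

    entry-fromBelow : ∀ b → In b → hasBelow b ≡ true → V T b ≡ 1
    entry-fromBelow b s eD with entry-1-or-2 b s | entry-1-or-2 (belowOf b) eD
    ... | inj₁ e  | _       = e
    ... | inj₂ e₂ | inj₁ e₁ = ⊥-elim (2≰1 (subst₂ _≤_ e₂ e₁ (colInc (row b) (col b) (fromIn s) (fromIn eD))))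
    ... | inj₂ e₂ | inj₂ e₂′ = ⊥-elim (¬Primed2 (subst Primed e₂
          (colUnpr b (belowOf b) (fromIn s) (fromIn eD) (λ e → ℕₚ.1+n≢n (sym (cong row e))) refl (trans e₂ (sym e₂′)))))

    entry-forced : ∀ b → In b → hasPrev b ≡ true → V T b ≡ forcedEntry b
    entry-forced b s hp with prev-cases b hp
    ... | inj₁ (eL , _)      = trans (entry-fromLeft b s eL) (sym (if-true 2 1 eL))
    ... | inj₂ (eL , eD , _) = trans (entry-fromBelow b s eD) (sym (if-false 2 1 eL))

    joinsPrev⇒sameBar : ∀ b → In b → joinsPrev f b ≡ true → rep T b ≡ rep T (prev b)
    joinsPrev⇒sameBar b s j = eqBox⇒≡ _ _
      (joins-optionOf (boxType b) (V T b) (V T (prev b)) (matchingEntry (hasRight (prev b))) (eqBox (rep T b) (rep T (prev b)))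
        (subst (λ o → joins (boxType b) o ≡ true) (f≗ b s) j))

    sameBar⇒joinsPrev : ∀ b → In b → hasPrev b ≡ true → rep T b ≡ rep T (prev b) → joinsPrev f b ≡ true
    sameBar⇒joinsPrev b s hp e = subst (λ o → joins (boxType b) o ≡ true) (sym (f≗ b s)) (go (boxType b) refl)
      where
      vp mv : ℕ
      vp = V T (prev b)
      mv = matchingEntry (hasRight (prev b))
      joined : Bool
      joined = eqBox (rep T b) (rep T (prev b))
      joined≡ : joined ≡ true
      joined≡ = ≡⇒eqBox _ _ e
      V≡ : V T b ≡ vp
      V≡ = barEntry b (prev b) (fromIn s) (fromIn (prev-In b hp)) e
      direction-injective : ∀ x y → (if x then 2 else 1) ≡ (if y then 2 else 1) → x ≡ y
      direction-injective true  true  _ = refl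
      direction-injective false false _ = refl
      go : ∀ k → boxType b ≡ k → joins k (optionOf k (V T b) vp mv joined) ≡ true
      go isolated et = ⊥-elim (true≢false (trans (sym hp) (proj₁ (classify-isolated et))))
      go first    et = ⊥-elim (true≢false (trans (sym hp) (proj₁ (classify-first et))))
      go second   _  = joins-optionOf-second (V T b) vp mv joined
                         (trans (sym V≡) (trans (entry-forced b s hp) (sym (matchingEntry-prev b s hp)))) joined≡
      go straight _  = cong (λ e → joins straight (if e then 1 else 0)) joined≡
      go turn     et = let _ , hpp , l≢lp = classify-turn et
                       in ⊥-elim (l≢lp (direction-injective (hasLeft b) (hasLeft (prev b))
                            (trans (sym (entry-forced b s hp)) (trans V≡ (entry-forced (prev b) (prev-In b hp) hpp)))))

    entries-agree : ∀ b → In b → V T b ≡ fill f b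
    entries-agree b s with true-or-false (hasPrev b)
    ... | inj₁ hp = trans (entry-forced b s hp) (sym (fill-forced f b hp))
    ... | inj₂ np with true-or-false (hasNext b)
    ...   | inj₂ nn = sym (begin
      fill f b
        ≡⟨ fill-isolated f b np nn ⟩
      ifZero (f b) 1 2
        ≡⟨ cong (λ o → ifZero o 1 2) (trans (f≗ b s) (cong (λ k → optionOf k (V T b) vp mv joined) (boxType-isolated b np nn))) ⟩
      ifZero (optionOf isolated (V T b) vp mv joined) 1 2
        ≡⟨ ifZero-optionOf-isolated (V T b) vp mv joined (entry-1-or-2 b s) ⟩
      V T b ∎)
      where
      open ≡-Reasoning
      vp mv : ℕ
      vp = V T (prev b)
      mv = matchingEntry (hasRight (prev b))
      joined : Bool
      joined = eqBox (rep T b) (rep T (prev b))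
    ...   | inj₁ hn = sym (trans (fill-first f b np hn)
      (trans (cong (λ o → ifZero o (otherEntry r) (matchingEntry r)) (trans (f≗ c (next-In b hn)) (choiceOf-second)))
             (ifZero-optionOf-second (V T c) (V T b) r _ (entry-1-or-2 b s))))
      where
      c : Box
      c = next b
      r : Bool
      r = hasRight b
      choiceOf-second : choiceOf T c ≡ optionOf second (V T c) (V T b) (matchingEntry r) (eqBox (rep T c) (rep T b))
      choiceOf-second = let hpc , pc≡b = prev-next b s hn in
        cong₂ (λ k p → optionOf k (V T c) (V T p) (matchingEntry (hasRight p)) (eqBox (rep T c) (rep T p)))
              (boxType-second c hpc (trans (cong hasPrev pc≡b) np)) pc≡b

    sameBar-barHead : ∀ b → In b → rep T b ≡ rep T (barHead f b)
    sameBar-barHead = origin-ind (λ b → rep T b ≡ rep T (barHead f b)) (λ b _ _ e → cong (rep T) (sym e))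
                        (λ b s j e ih → trans (joinsPrev⇒sameBar b s j) (trans ih (cong (rep T) (sym e))))

    -- Inside a bar of T every box joins its predecessor, so barHead f is constant along it.
    rowSegment-barHead : ∀ b c → In b → In c → row b ≡ row c → col b ≤ col c → rep T b ≡ rep T c →
                         barHead f c ≡ barHead f b
    rowSegment-barHead b c sb sc re b≤c e = subst (λ i → barHead f (i , col c) ≡ barHead f b) re (go (col c) b≤c ℕₚ.≤-refl)
      where
      between : ∀ k → col b ≤ k → k ≤ col c → In (row b , k) × rep T (row b , k) ≡ rep T b
      between k lo hi = let d∈ , same = barContig b c (row b , k) (fromIn sb) (fromIn sc) e (inj₁ (re , refl , lo , hi))
                        in toIn d∈ , same
      go : ∀ k → col b ≤ k → k ≤ col c → barHead f (row b , k) ≡ barHead f b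
      go k lo hi with ℕₚ.m≤n⇒m<n∨m≡n lo
      ... | inj₂ refl = refl
      go (suc k) lo hi | inj₁ (s≤s b≤k) =
        let x = (row b , suc k)
            x∈ , ex = between (suc k) lo hi
            y∈ , ey = between k b≤k (ℕₚ.≤-trans (ℕₚ.n≤1+n k) hi)
            hp = ∨-true⁺ˡ (hasBelow x) y∈
            px≡y = if-true (leftOf x) (belowOf x) y∈
            j = sameBar⇒joinsPrev x x∈ hp (trans ex (trans (sym ey) (cong (rep T) (sym px≡y))))
        in trans (barHead-joinsPrev x j) (trans (cong (barHead f) px≡y) (go k b≤k (ℕₚ.≤-trans (ℕₚ.n≤1+n k) hi)))

    columnSegment-barHead : ∀ b c → In b → In c → col b ≡ col c → row b ≤ row c → rep T b ≡ rep T c →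
                            barHead f b ≡ barHead f c
    columnSegment-barHead b c sb sc ce b≤c e = subst (λ j → barHead f b ≡ barHead f (row c , j)) ce (go (row c) b≤c ℕₚ.≤-refl)
      where
      between : ∀ k → row b ≤ k → k ≤ row c → In (k , col b) × rep T (k , col b) ≡ rep T b
      between k lo hi = let d∈ , same = barContig b c (k , col b) (fromIn sb) (fromIn sc) e (inj₂ (ce , refl , lo , hi))
                        in toIn d∈ , same
      go : ∀ k → row b ≤ k → k ≤ row c → barHead f b ≡ barHead f (k , col b)
      go k lo hi with ℕₚ.m≤n⇒m<n∨m≡n lo
      ... | inj₂ refl = refl
      go (suc k) lo hi | inj₁ (s≤s b≤k) =
        let x = (k , col b)
            x∈ , ex = between k b≤k (ℕₚ.≤-trans (ℕₚ.n≤1+n k) hi)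
            y∈ , ey = between (suc k) lo hi
            hp = ∨-true⁺ʳ (hasLeft x) y∈
            px≡y = if-false (leftOf x) (belowOf x) (hasBelow⇒¬hasLeft x y∈)
            j = sameBar⇒joinsPrev x x∈ hp (trans ex (trans (sym ey) (cong (rep T) (sym px≡y))))
        in trans (go k b≤k (ℕₚ.≤-trans (ℕₚ.n≤1+n k) hi)) (trans (barHead-joinsPrev x j) (cong (barHead f) px≡y))

    bars-agree : ∀ b c → In b → In c →
                 (rep T b ≡ rep T c → barHead f b ≡ barHead f c) × (barHead f b ≡ barHead f c → rep T b ≡ rep T c)
    bars-agree b c sb sc = sameRep⇒sameHead , λ e → trans (sameBar-barHead b sb) (trans (cong (rep T) e) (sym (sameBar-barHead c sc)))
      where
      sameRep⇒sameHead : rep T b ≡ rep T c → barHead f b ≡ barHead f c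
      sameRep⇒sameHead e with barLine b c (fromIn sb) (fromIn sc) e
      ... | inj₁ re with ℕₚ.≤-total (col b) (col c)
      ...   | inj₁ le = sym (rowSegment-barHead b c sb sc re le e)
      ...   | inj₂ le = rowSegment-barHead c b sc sb (sym re) le (sym e)
      sameRep⇒sameHead e | inj₂ ce with ℕₚ.≤-total (row b) (row c)
      ...   | inj₁ le = columnSegment-barHead b c sb sc ce le e
      ...   | inj₂ le = sym (columnSegment-barHead c b sc sb (sym ce) le (sym e))

    ≈tableauOf : T ≈[ Λ , Ψ ] tableauOf f
    ≈tableauOf = (λ b s → entries-agree b (toIn s)) , (λ b c sb sc → bars-agree b c (toIn sb) (toIn sc))

  module StartWalk = Origin hasPrev (λ _ hp → hp)

  start : Box → Box
  start = origin hasPrev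

  start-In : ∀ b → In b → In (start b)
  start-In = StartWalk.origin-In

  Adj⇒prev : ∀ b c → In b → In c → Adj b c → (hasPrev c ≡ true × prev c ≡ b) ⊎ (hasPrev b ≡ true × prev b ≡ c)
  Adj⇒prev (i , j)       (.i , .(suc j))   sb sc (inj₁ (refl , inj₁ refl)) = inj₁ (∨-true⁺ˡ _ sb , if-true _ _ sb)
  Adj⇒prev (i , .(suc j)) (.i , j)         sb sc (inj₁ (refl , inj₂ refl)) = inj₂ (∨-true⁺ˡ _ sc , if-true _ _ sc)
  Adj⇒prev (i , j)       (.(suc i) , .j)   sb sc (inj₂ (refl , inj₁ refl)) =
    inj₂ (∨-true⁺ʳ (hasLeft (i , j)) sc , if-false _ _ (hasBelow⇒¬hasLeft (i , j) sc))
  Adj⇒prev (.(suc i) , j) (i , .j)         sb sc (inj₂ (refl , inj₂ refl)) =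
    inj₁ (∨-true⁺ʳ (hasLeft (i , j)) sb , if-false _ _ (hasBelow⇒¬hasLeft (i , j) sb))

  Adj-prev : ∀ b → hasPrev b ≡ true → Adj b (prev b) × Adj (prev b) b
  Adj-prev (i , j) hp with prev-cases (i , j) hp
  Adj-prev (i , zero)  hp | inj₁ (eL , _) with In⇒col-suc i zero eL
  ... | _ , ()
  Adj-prev (i , suc j) hp | inj₁ (_ , ep) =
    subst (λ c → Adj (i , suc j) c × Adj c (i , suc j)) (sym ep) (inj₁ (refl , inj₂ refl) , inj₁ (refl , inj₁ refl))
  Adj-prev (i , j)     hp | inj₂ (_ , _ , ep) =
    subst (λ c → Adj (i , j) c × Adj c (i , j)) (sym ep) (inj₂ (refl , inj₁ refl) , inj₂ (refl , inj₂ refl))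

  start-prev : ∀ b → hasPrev b ≡ true → start b ≡ start (prev b)
  start-prev b hp with StartWalk.origin-step b
  ... | inj₁ (np , _) = ⊥-elim (true≢false (trans (sym hp) np))
  ... | inj₂ (_ , e)  = e

  start-self : ∀ b → hasPrev b ≡ false → start b ≡ b
  start-self b np with StartWalk.origin-step b
  ... | inj₁ (_ , e)  = e
  ... | inj₂ (hp , _) = ⊥-elim (true≢false (trans (sym hp) np))

  start-Adj : ∀ b c → In b → In c → Adj b c → start b ≡ start c
  start-Adj b c sb sc a with Adj⇒prev b c sb sc a
  ... | inj₁ (hp , e) = sym (trans (start-prev c hp) (cong start e))
  ... | inj₂ (hp , e) = trans (start-prev b hp) (cong start e)

  Reach-target : ∀ {b c} → Reach Λ Ψ b c → Sk Λ Ψ c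
  Reach-target (here s)     = s
  Reach-target (step _ _ s) = s

  Reach-trans : ∀ {a b c} → Reach Λ Ψ a b → Reach Λ Ψ b c → Reach Λ Ψ a c
  Reach-trans r (here _)        = r
  Reach-trans r (step r′ a s)   = step (Reach-trans r r′) a s

  Reach⇒start≡ : ∀ {b c} → Reach Λ Ψ b c → start b ≡ start c
  Reach⇒start≡ (here _) = refl
  Reach⇒start≡ (step {c = c} {d = d} r a s) = trans (Reach⇒start≡ r) (start-Adj c d (toIn (Reach-target r)) (toIn s) a)

  Reach-to-start : ∀ b → In b → Reach Λ Ψ b (start b)
  Reach-to-start = StartWalk.origin-ind (λ b → Reach Λ Ψ b (start b))
    (λ b s _ e → subst (Reach Λ Ψ b) (sym e) (here (fromIn s)))
    (λ b s hp e ih → subst (Reach Λ Ψ b) (sym e)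
       (Reach-trans (step (here (fromIn s)) (proj₁ (Adj-prev b hp)) (fromIn (prev-In b hp))) ih))

  Reach-from-start : ∀ b → In b → Reach Λ Ψ (start b) b
  Reach-from-start = StartWalk.origin-ind (λ b → Reach Λ Ψ (start b) b)
    (λ b s _ e → subst (λ a → Reach Λ Ψ a b) (sym e) (here (fromIn s)))
    (λ b s hp e ih → subst (λ a → Reach Λ Ψ a b) (sym e) (step ih (proj₂ (Adj-prev b hp)) (fromIn s)))

  hasNext-start : ∀ b → In b → hasPrev b ≡ true → hasNext (start b) ≡ true
  hasNext-start = StartWalk.origin-ind (λ b → hasPrev b ≡ true → hasNext (start b) ≡ true)
    (λ b _ np _ hp → ⊥-elim (true≢false (trans (sym hp) np)))
    (λ b s hp e ih _ → subst (λ a → hasNext a ≡ true) (sym e) (prevCase b s hp ih))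
    where
    prevCase : ∀ b → In b → hasPrev b ≡ true → (hasPrev (prev b) ≡ true → hasNext (start (prev b)) ≡ true) →
               hasNext (start (prev b)) ≡ true
    prevCase b s hp ih with true-or-false (hasPrev (prev b))
    ... | inj₁ hpp = ih hpp
    ... | inj₂ npp = subst (λ a → hasNext a ≡ true) (sym (start-self (prev b) npp)) (proj₁ (next-prev b s hp))

  start-first : ∀ b → In b → HasNbr Λ Ψ b → boxType (start b) ≡ first
  start-first b s (d , a , sd) = boxType-first (start b) (StartWalk.origin-stops b s) (hasNext-start′ (true-or-false (hasPrev b)))
    where
    hasNext-start′ : hasPrev b ≡ true ⊎ hasPrev b ≡ false → hasNext (start b) ≡ true
    hasNext-start′ (inj₁ hp) = hasNext-start b s hp
    hasNext-start′ (inj₂ np) with Adj⇒prev b d s (toIn sd) a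
    ... | inj₁ (hpd , pd≡b) = subst (λ c → hasNext c ≡ true) (sym (start-self b np))
                                (subst (λ c → hasNext c ≡ true) pd≡b (proj₁ (next-prev d (toIn sd) hpd)))
    ... | inj₂ (hp , _)     = ⊥-elim (true≢false (trans (sym hp) np))

  open Choices (×-≡-dec ℕₚ._≟_ ℕₚ._≟_) (options ∘ boxType) 0 public

  boxes : List Box
  boxes = skewBoxes Λ Ψ

  ∈boxes⇒In : ∀ {b} → b ∈ boxes → In b
  ∈boxes⇒In b∈ = toIn (∈-skewBoxes⁻ Λ Ψ b∈)

  In⇒∈boxes : ∀ {b} → In b → b ∈ boxes
  In⇒∈boxes s = ∈-skewBoxes⁺ Λ Ψ (fromIn s)

  count : BoxType → ℕ
  count k = countType boxType k boxes

  tableaux : List Tableau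
  tableaux = map tableauOf (choices boxes)

  term-tableauOf : ∀ f t β → term Λ Ψ (tableauOf f) t β ≡ prodBy (λ b → optionWeight t β (boxType b) (f b)) boxes
  term-tableauOf f t β = begin
    (- β) ^ (size Λ Ψ ∸ numBars Λ Ψ (tableauOf f)) * monoAt Λ Ψ (tableauOf f) (spec t)
      ≡⟨ cong₂ (λ e m → (- β) ^ e * m) joined≡ (trans (monoAt-spec (barReps Λ Ψ (tableauOf f))) (cong (t ^_) bars≡)) ⟩
    (- β) ^ length (filterB (joinsPrev f) boxes) * t ^ length (filterB (λ b → not (joinsPrev f b)) boxes)
      ≡⟨ sym (prodBy-if (joinsPrev f) (- β) t boxes) ⟩
    prodBy (λ b → optionWeight t β (boxType b) (f b)) boxes ∎
    where
    open ≡-Reasoning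
    open OfChoice f
    joined unjoined : ℕ
    joined = length (filterB (joinsPrev f) boxes)
    unjoined = length (filterB (λ b → not (joinsPrev f b)) boxes)
    bars≡ : numBars Λ Ψ (tableauOf f) ≡ unjoined
    bars≡ = cong length (filterB-cong _ _ boxes (λ b b∈ → eqBox-barHead-self b (∈boxes⇒In b∈)))
    joined≡ : size Λ Ψ ∸ numBars Λ Ψ (tableauOf f) ≡ joined
    joined≡ = trans (cong₂ _∸_ (trans (size≡length-skewBoxes Λ Ψ Ψ⊆Λ) (sym (length-filterB-split (joinsPrev f) boxes))) bars≡)
                    (ℕₚ.m+n∸n≡m joined unjoined)
    spec-fill : ∀ b → spec t (varIndex (fill f b)) ≡ t
    spec-fill b with fill-1-or-2 f b
    ... | inj₁ e rewrite e = refl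
    ... | inj₂ e rewrite e = refl
    monoAt-spec : ∀ bs → foldr (λ b acc → spec t (varIndex (fill f b)) * acc) 1ℤ bs ≡ t ^ length bs
    monoAt-spec []       = refl
    monoAt-spec (b ∷ bs) = cong₂ _*_ (spec-fill b) (monoAt-spec bs)

  sumTerms-tableaux : ∀ t β → sumTerms Λ Ψ tableaux t β ≡
    (+ 2 * t) ^ count isolated * t ^ count first * (+ 2 * t - β) ^ count second * (t - β) ^ count straight * t ^ count turn
  sumTerms-tableaux t β = begin
    sumTerms Λ Ψ (map tableauOf (choices boxes)) t β
      ≡⟨ sumBy-map (λ T → term Λ Ψ T t β) tableauOf (choices boxes) ⟩
    sumBy (λ f → term Λ Ψ (tableauOf f) t β) (choices boxes)
      ≡⟨ sumBy-cong (choices boxes) (λ {f} _ → term-tableauOf f t β) ⟩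
    sumBy (λ f → prodBy (λ b → weight b (f b)) boxes) (choices boxes)
      ≡⟨ sum-choices-prod weight (skewBoxes-Unique Λ Ψ) ⟩
    prodBy (λ b → sumBy (weight b) (options (boxType b))) boxes
      ≡⟨ prodBy-cong boxes (λ {b} _ → sumBy-optionWeight t β (boxType b)) ⟩
    prodBy (typeWeight t β ∘ boxType) boxes
      ≡⟨ prodBy-byType boxType (typeWeight t β) boxes ⟩
    (+ 2 * t) ^ count isolated * t ^ count first * (+ 2 * t - β) ^ count second * (t - β) ^ count straight * t ^ count turn ∎
    where
    open ≡-Reasoning
    weight : Box → ℕ → ℤ
    weight b = optionWeight t β (boxType b)

  scc≡count-isolated : scc Λ Ψ ≡ count isolated
  scc≡count-isolated = cong length (filterB-cong _ _ boxes (λ b _ → isolated-iff b))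
    where
    isolated-iff : ∀ b → not (any (skew Λ Ψ) (nbrs b)) ≡ does (isolated ≟ᵗ boxType b)
    isolated-iff b = begin
      not (any (skew Λ Ψ) (nbrs b))                     ≡⟨ cong (not ∘ or) (map-cong (λ c → sym (S≡skew c)) (nbrs b)) ⟩
      not (any S (nbrs b))                              ≡⟨ cong not (∨-shuffle (hasRight b) (hasLeft b) (hasBelow b) (hasAbove b)) ⟩
      not (hasPrev b ∨ hasNext b)                       ≡⟨ sym (isolated?-boxType b) ⟩
      does (isolated ≟ᵗ boxType b)                     ∎
      where open ≡-Reasoning

  fb≡count-turn : fb Λ Ψ ≡ count turn
  fb≡count-turn = cong length (filterB-cong _ _ boxes (λ b _ → forced-iff b))
    where
    forced-iff : ∀ b → isForced Λ Ψ b ≡ does (turn ≟ᵗ boxType b)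
    forced-iff b = trans (cong₂ _∨_ (cong₂ _∧_ (sym (S≡skew _)) (sym (S≡skew _)))
                                    (cong₂ _∧_ (sym (S≡skew _)) (sym (S≡skew _))))
                         (sym (turn?-boxType b))

  ofType : BoxType → List Box
  ofType k = filterB (λ b → does (k ≟ᵗ boxType b)) boxes

  ofType-Unique : ∀ k → Unique (ofType k)
  ofType-Unique k = filterB-Unique _ boxes (skewBoxes-Unique Λ Ψ)

  ∈-ofType⁻ : ∀ {k b} → b ∈ ofType k → In b × boxType b ≡ k
  ∈-ofType⁻ {k} {b} b∈ =
    let b∈boxes , isK = ∈-filterB⁻ _ boxes b∈ in ∈boxes⇒In b∈boxes , sym (does≡true⇒ (k ≟ᵗ boxType b) isK)

  ∈-ofType⁺ : ∀ {k b} → In b → boxType b ≡ k → b ∈ ofType k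
  ∈-ofType⁺ {k} {b} s e = ∈-filterB⁺ _ boxes (In⇒∈boxes s) (dec-true (k ≟ᵗ boxType b) (sym e))

  count-first≡count-second : count first ≡ count second
  count-first≡count-second = trans (sym (length-map next (ofType first)))
    (Unique-⊆-⊇⇒length≡ (map next (ofType first)) (ofType second)
      (AllPairsₚ.map⁺ (AllPairs-zipWith-All (ofType-Unique first) (All.tabulate first-info) next-injective))
      (ofType-Unique second) next∈ prev∈)
    where
    first-info : ∀ {b} → b ∈ ofType first → In b × hasNext b ≡ true
    first-info b∈ = let s , e = ∈-ofType⁻ b∈ in s , proj₂ (classify-first e)
    next-injective : ∀ {b c} → In b × hasNext b ≡ true → In c × hasNext c ≡ true → b ≢ c → next b ≢ next c
    next-injective {b} {c} (sb , hb) (sc , hc) b≢c e =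
      b≢c (trans (sym (proj₂ (prev-next b sb hb))) (trans (cong prev e) (proj₂ (prev-next c sc hc))))
    next∈ : ∀ {c} → c ∈ map next (ofType first) → c ∈ ofType second
    next∈ c∈ with ∈-map⁻ next c∈
    ... | b , b∈ , refl =
      let sb , e = ∈-ofType⁻ b∈
          np , hn = classify-first e
          hp , pn≡b = prev-next b sb hn
      in ∈-ofType⁺ (next-In b hn) (boxType-second (next b) hp (trans (cong hasPrev pn≡b) np))
    prev∈ : ∀ {c} → c ∈ ofType second → c ∈ map next (ofType first)
    prev∈ {c} c∈ =
      let sc , e = ∈-ofType⁻ c∈
          hp , npp = classify-second e
          hn , np≡c = next-prev c sc hp
      in subst (_∈ map next (ofType first)) np≡c (∈-map⁺ next (∈-ofType⁺ (prev-In c hp) (boxType-first (prev c) npp hn)))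

  length-reps≡count-first : ∀ reps → MCCReps Λ Ψ reps → length reps ≡ count first
  length-reps≡count-first reps (reps-ok , reps-apart , reps-cover) = trans (sym (length-map start reps))
    (Unique-⊆-⊇⇒length≡ (map start reps) (ofType first)
      (AllPairsₚ.map⁺ (AllPairs-zipWith-All reps-apart reps-ok start-injective))
      (ofType-Unique first) start∈ first∈)
    where
    start-injective : ∀ {r r′} → Sk Λ Ψ r × HasNbr Λ Ψ r → Sk Λ Ψ r′ × HasNbr Λ Ψ r′ →
                      ¬ Reach Λ Ψ r r′ → start r ≢ start r′
    start-injective {r} {r′} (sr , _) (sr′ , _) unreachable e =
      unreachable (Reach-trans (Reach-to-start r (toIn sr)) (subst (λ a → Reach Λ Ψ a r′) (sym e) (Reach-from-start r′ (toIn sr′))))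
    start∈ : ∀ {c} → c ∈ map start reps → c ∈ ofType first
    start∈ c∈ with ∈-map⁻ start c∈
    ... | r , r∈ , refl = let sr , nbr = All.lookup reps-ok r∈ in
      ∈-ofType⁺ (start-In r (toIn sr)) (start-first r (toIn sr) nbr)
    reached : ∀ {b} rs → hasPrev b ≡ false → Any (λ r → Reach Λ Ψ r b) rs → b ∈ map start rs
    reached (r ∷ rs) np (here r⇝b) = here (sym (trans (Reach⇒start≡ r⇝b) (start-self _ np)))
    reached (r ∷ rs) np (there any) = there (reached rs np any)
    first∈ : ∀ {b} → b ∈ ofType first → b ∈ map start reps
    first∈ {b} b∈ =
      let sb , e = ∈-ofType⁻ b∈
          np , hn = classify-first e
          hp , pn≡b = prev-next b sb hn
          adj = subst (λ a → Adj a (next b)) pn≡b (proj₂ (Adj-prev (next b) hp))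
      in reached reps np (reps-cover b (fromIn sb) (next b , adj , fromIn (next-In b hn)))

  res-2≡count-straight : ∀ reps → MCCReps Λ Ψ reps → res Λ Ψ (length reps) - + 2 ≡ + count straight
  res-2≡count-straight reps mcc =
    trans (cong₂ (λ n i → + n - + i - + (2 ℕ.* length reps) - + fb Λ Ψ + + 2 - + 2)
                 (trans (size≡length-skewBoxes Λ Ψ Ψ⊆Λ) (length-byType boxType boxes)) scc≡count-isolated)
      (trans (cong₂ (λ m u → + total - + count isolated - + (2 ℕ.* m) - + u + + 2 - + 2)
                    (length-reps≡count-first reps mcc) fb≡count-turn)
             (res-arith (count isolated) (count first) (count second) (count straight) (count turn) count-first≡count-second))
    where
    total : ℕ
    total = count isolated ℕ.+ count first ℕ.+ count second ℕ.+ count straight ℕ.+ count turn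

  tableaux-semistandard : All (IsSemistandard Λ Ψ) tableaux
  tableaux-semistandard = Allₚ.map⁺ (All.tabulate {xs = choices boxes} (λ {f} _ → OfChoice.isSemistandard f))

  tableaux-distinct : AllPairs (λ T T′ → ¬ (T ≈[ Λ , Ψ ] T′)) tableaux
  tableaux-distinct = AllPairsₚ.map⁺ (AllPairs-zipWith-All
    (choices-differ (options-Unique ∘ boxType) (skewBoxes-Unique Λ Ψ)) (All.tabulate (λ f∈ → f∈))
    (λ {f} {g} f∈ g∈ (b , b∈ , fb≢gb) → tableauOf-≉ f g b (∈boxes⇒In b∈)
       (∈-choices⁻ (skewBoxes-Unique Λ Ψ) f∈ b∈) (∈-choices⁻ (skewBoxes-Unique Λ Ψ) g∈ b∈) fb≢gb))

  -- A bar whose entry is neither 1′ nor 1 contributes a variable x_i with i ≥ 2, which vanishes at t.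
  term≡0 : ∀ T → IsSemistandard Λ Ψ T → ∀ {b} → b ∈ boxes → V T b ≢ 1 → V T b ≢ 2 →
           ∀ t β → term Λ Ψ T t β ≡ 0ℤ
  term≡0 T ss {b} b∈ ≢1 ≢2 t β =
    trans (cong ((- β) ^ (size Λ Ψ ∸ numBars Λ Ψ T) *_) (prodBy-zero (λ c → spec t (varIndex (V T c))) r∈ spec≡0))
          (ℤₚ.*-zeroʳ ((- β) ^ (size Λ Ψ ∸ numBars Λ Ψ T)))
    where
    open IsBarTableau (IsSemistandard.bar ss)
    sb : Sk Λ Ψ b
    sb = ∈-skewBoxes⁻ Λ Ψ b∈
    r∈ : rep T b ∈ barReps Λ Ψ T
    r∈ = ∈-filterB⁺ _ boxes (∈-skewBoxes⁺ Λ Ψ (repSk b sb)) (≡⇒eqBox _ _ (repIdem b sb))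
    spec≡0 : spec t (varIndex (V T (rep T b))) ≡ 0ℤ
    spec≡0 = subst (λ v → spec t (varIndex v) ≡ 0ℤ) (sym (barEntry (rep T b) b (repSk b sb) sb (repIdem b sb)))
                   (spec-varIndex≡0 t (V T b) ≢1 ≢2)

  entry-1-or-2? : ∀ T b → Dec (V T b ≡ 1 ⊎ V T b ≡ 2)
  entry-1-or-2? T b = (V T b ℕₚ.≟ 1) ⊎-dec (V T b ℕₚ.≟ 2)

  tableaux-complete : ∀ T → IsSemistandard Λ Ψ T → All (λ T′ → ¬ (T ≈[ Λ , Ψ ] T′)) tableaux →
                      ∀ t β → term Λ Ψ T t β ≡ 0ℤ
  tableaux-complete T ss T≉ t β with all? (entry-1-or-2? T) boxes
  ... | no ¬entries = let b , b∈ , ¬1or2 = find (Allₚ.¬All⇒Any¬ (entry-1-or-2? T) boxes ¬entries)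
                      in term≡0 T ss b∈ (¬1or2 ∘ inj₁) (¬1or2 ∘ inj₂) t β
  ... | yes entries with ∈-choices⁺ (skewBoxes-Unique Λ Ψ) (choiceOf T) (λ {b} _ → choiceOf-∈ T b)
  ...   | f , f∈ , f≗ = ⊥-elim (All.lookup T≉ (∈-map⁺ tableauOf f∈)
            (Agreement.≈tableauOf T ss (λ b s → All.lookup entries (In⇒∈boxes s)) f (λ b s → f≗ (In⇒∈boxes s))))

  sumTerms-identity : ∀ reps → MCCReps Λ Ψ reps → ∀ t β →
    sumTerms Λ Ψ tableaux t β
      * (t - β) ^ neg (res Λ Ψ (length reps) - + 2)
      * t ^ neg (+ scc Λ Ψ + + length reps + + fb Λ Ψ - + 1)
      * (+ 2 * t - β) ^ neg (+ length reps - + 1)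
    ≡ (+ 2 * t * t - β * t)
      * (t - β) ^ pos (res Λ Ψ (length reps) - + 2)
      * (+ 2) ^ scc Λ Ψ
      * t ^ pos (+ scc Λ Ψ + + length reps + + fb Λ Ψ - + 1)
      * (+ 2 * t - β) ^ pos (+ length reps - + 1)
  sumTerms-identity reps mcc t β
    rewrite sumTerms-tableaux t β | res-2≡count-straight reps mcc | scc≡count-isolated | fb≡count-turn
          | length-reps≡count-first reps mcc | sym count-first≡count-second =
    generating-identity t β (count isolated) (count first) (count straight) (count turn)

lemma4p7 : (Λ Ψ : List ℕ) → StrictPartition Λ → StrictPartition Ψ →
  drop 1 Λ ⊆SD Ψ → Ψ ⊆SD Λ →
  (reps : List Box) → MCCReps Λ Ψ reps →
  Σ (List Tableau) (λ L →
      All (IsSemistandard Λ Ψ) L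
    × AllPairs (λ T T' → ¬ (T ≈[ Λ , Ψ ] T')) L
    × (∀ T → IsSemistandard Λ Ψ T → All (λ T' → ¬ (T ≈[ Λ , Ψ ] T')) L →
         ∀ t β → term Λ Ψ T t β ≡ 0ℤ)
    × (∀ t β →
         sumTerms Λ Ψ L t β
           * (t - β) ^ neg (res Λ Ψ (length reps) - + 2)
           * t ^ neg (+ scc Λ Ψ + + length reps + + fb Λ Ψ - + 1)
           * (+ 2 * t - β) ^ neg (+ length reps - + 1)
         ≡ (+ 2 * t * t - β * t)
           * (t - β) ^ pos (res Λ Ψ (length reps) - + 2)
           * (+ 2) ^ scc Λ Ψ
           * t ^ pos (+ scc Λ Ψ + + length reps + + fb Λ Ψ - + 1)
           * (+ 2 * t - β) ^ pos (+ length reps - + 1)))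
lemma4p7 Λ Ψ (_ , Λ-decreasing) (_ , Ψ-decreasing) Γ⊆Ψ Ψ⊆Λ reps mcc =
  tableaux , tableaux-semistandard , tableaux-distinct , tableaux-complete , sumTerms-identity reps mcc
  where
  open RibbonTableaux Λ Ψ (skew Λ Ψ) (λ _ → refl) (skew-isRibbonShape Λ Ψ Λ-decreasing Ψ-decreasing Γ⊆Ψ) Ψ⊆Λ
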